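{- Let $Q\in\mathrm{QPD}_0(w)$. Then \[ \mathfrak F_Q=\sum_{P} \mathbf x^P, \] where the sum is taken over all facets $P$ of the complex $\widetilde\Delta(\mathcal Q_{0,n}, \mathrm{word}(Q))$.
   Context: Pipe dreams: $n\times n$ squares filled with crosses and elbows, crosses strictly above the antidiagonal; reduced if each pair of strands crosses at most once; the shape of a reduced pipe dream is the permutation given by its strands. For a pipe dream $P$ with set of cross coordinates $D_P$, $\mathbf x^P=\prod_{(i,j)\in D_P}x_i$. Slide move $S_i$: if the leftmost cross in row $i$ is not in column 1 and lies strictly right of the rightmost cross in row $i+1$, move it one step southwest; otherwise identity. $\mathrm{QPD}_0(w)$ is the set of reduced quasi-Yamanouchi pipe dreams of shape $w\in\mathbf S_n$ (all $S_i$ act identically). $\mathrm{dst}_0$ maps a reduced pipe dream of shape $w$ to the quasi-Yamanouchi one obtained by applying slide moves repeatedly; the slide polynomial is $\mathfrak F_Q=\sum_{P\in\mathrm{dst}_0^{ -1}(Q)}\mathbf x^P$. $\mathcal Q_{0,n}=(s_{n-1}\dots s_1)(s_{n-1}\dots s_2)\dots(s_{n-1})$, read from the staircase table with $s_{i+j-1}$ in cell $(i,j)$ (right to left, top to bottom); $\mathrm{word}(P)$ is the subword given by the cells of the crosses of $P$, and faces $\mathcal Q_{0,n}\smallsetminus\mathrm{word}(P)$ are identified with pipe dreams $P$. The slide complex $\widetilde\Delta(\mathcal Q,\mathcal S)$ is the simplicial complex of subwords $\mathcal Q\smallsetminus\mathcal P$ whose complement $\mathcal P$ contains $\mathcal S$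 as a subword. -}

module Defs where

open import Data.Bool using (Bool; true; false; _∧_; _∨_; not; if_then_else_; T)
open import Data.Nat using (ℕ; zero; suc; _+_; _*_; _∸_; _<ᵇ_; _≡ᵇ_)
import Data.Nat as ℕ
open import Data.Product using (_×_; _,_; proj₁; proj₂)
open import Data.Maybe using (Maybe; just; nothing)
import Data.Maybe as Maybe
open import Data.List using (List; []; _∷_; map; filter; concatMap; length; upTo; downFrom; allFin)
open import Data.Vec as V using (Vec)
open import Data.Fin using (Fin; toℕ)
open import Data.Fin.Permutation using (Permutation′; _⟨$⟩ʳ_)
open import Relation.Nullary using (does)
open import Relation.Nullary.Decidable using (T?)
open import Data.List.Relation.Binary.Sublist.DecPropositional ℕ._≟_ using (_⊆?_)
open import Data.List.Relation.Binary.Permutation.Propositional using (_↭_)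

-- Conventions (0-indexed): row r, column c, both in {0,…,n-1}.
-- Paper's cell (i,j) = our (r+1, c+1).  A cross is allowed at (r,c)
-- iff r + c + 2 ≤ n (strictly above the antidiagonal i + j = n + 1).

-- an n × n square filled with crosses (true) and elbows (false); rows first
Grid : ℕ → Set
Grid n = Vec (Vec Bool n) n

all : ∀ {A : Set} → (A → Bool) → List A → Bool
all p [] = true
all p (x ∷ xs) = p x ∧ all p xs

vat : ∀ {A : Set} {m} → A → Vec A m → ℕ → A
vat d V.[] _ = d
vat d (x V.∷ xs) zero = x
vat d (x V.∷ xs) (suc k) = vat d xs k

vmod : ∀ {A : Set} {m} → Vec A m → ℕ → (A → A) → Vec A m
vmod V.[] _ f = V.[]
vmod (x V.∷ xs) zero f = f x V.∷ xs
vmod (x V.∷ xs) (suc k) f = x V.∷ vmod xs k f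

vecEq : ∀ {A : Set} {m} → (A → A → Bool) → Vec A m → Vec A m → Bool
vecEq e V.[] V.[] = true
vecEq e (x V.∷ xs) (y V.∷ ys) = e x y ∧ vecEq e xs ys

boolEq : Bool → Bool → Bool
boolEq true b = b
boolEq false b = not b

gridEq : ∀ {n} → Grid n → Grid n → Bool
gridEq = vecEq (vecEq boolEq)

crossAt : ∀ {n} → Grid n → ℕ → ℕ → Bool
crossAt P r c = vat false (V.map (λ row → vat false row c) P) r

rowAt : ∀ {n} → Grid n → ℕ → Vec Bool n
rowAt {n} P r = vat (V.replicate n false) P r

setCell : ∀ {n} → Grid n → ℕ → ℕ → Bool → Grid n
setCell P r c b = vmod P r (λ row → vmod row c (λ _ → b))

allCells : ℕ → List (ℕ × ℕ)
allCells n = concatMap (λ r → map (λ c → (r , c)) (upTo n)) (upTo n)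

isPipeDream : ∀ {n} → Grid n → Bool
isPipeDream {n} P =
  all (λ rc → not (crossAt P (proj₁ rc) (proj₂ rc)) ∨ (suc (proj₁ rc + proj₂ rc) <ᵇ n)) (allCells n)

allVecs : ∀ {A : Set} → List A → (k : ℕ) → List (Vec A k)
allVecs xs zero = V.[] ∷ []
allVecs xs (suc k) = concatMap (λ x → map (x V.∷_) (allVecs xs k)) xs

allGrids : (n : ℕ) → List (Grid n)
allGrids n = allVecs (allVecs (true ∷ false ∷ []) n) n

pipeDreams : (n : ℕ) → List (Grid n)
pipeDreams n = filter (λ P → T? (isPipeDream P)) (allGrids n)

-- Strands.  A strand enters row i from the left and travels east/north:
-- a cross sends west→east and south→north, an elbow sends west→north and
-- south→east.  It leaves through the top edge.

data Dir : Set where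
  fromWest fromSouth : Dir

walk : ∀ {n} → Grid n → (fuel : ℕ) → ℕ → ℕ → Dir → List (ℕ × ℕ) × ℕ
walk P zero r c d = [] , c
walk P (suc f) r c d = step (crossAt P r c) d
  where
  cons : List (ℕ × ℕ) × ℕ → List (ℕ × ℕ) × ℕ
  cons (cs , e) = ((r , c) ∷ cs) , e
  goNorth' : ℕ → List (ℕ × ℕ) × ℕ
  goNorth' zero = ((r , c) ∷ []) , c
  goNorth' (suc r') = cons (walk P f r' c fromSouth)
  goNorth : List (ℕ × ℕ) × ℕ
  goNorth = goNorth' r
  step : Bool → Dir → List (ℕ × ℕ) × ℕ
  step true fromWest = cons (walk P f r (suc c) fromWest)
  step false fromSouth = cons (walk P f r (suc c) fromWest)
  step true fromSouth = goNorth
  step false fromWest = goNorth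

-- strand starting at the left of row i (each step increases c or decreases r,
-- so 2n steps suffice)
strand : ∀ {n} → Grid n → ℕ → List (ℕ × ℕ) × ℕ
strand {n} P i = walk P (n + n) i 0 fromWest

strandPath : ∀ {n} → Grid n → ℕ → List (ℕ × ℕ)
strandPath P i = proj₁ (strand P i)

exitCol : ∀ {n} → Grid n → ℕ → ℕ
exitCol P i = proj₂ (strand P i)

hasShape : ∀ {n} → Permutation′ n → Grid n → Bool
hasShape {n} w P = all (λ i → exitCol P (toℕ i) ≡ᵇ toℕ (w ⟨$⟩ʳ i)) (allFin n)

cellEq : ℕ × ℕ → ℕ × ℕ → Bool
cellEq (a , b) (c , d) = (a ≡ᵇ c) ∧ (b ≡ᵇ d)

elemCell : ℕ × ℕ → List (ℕ × ℕ) → Bool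
elemCell x [] = false
elemCell x (y ∷ ys) = cellEq x y ∨ elemCell x ys

crossings : ∀ {n} → Grid n → ℕ → ℕ → ℕ
crossings P a b =
  length (filter (λ rc → T? (crossAt P (proj₁ rc) (proj₂ rc) ∧ elemCell rc (strandPath P b)))
                 (strandPath P a))

isReduced : ∀ {n} → Grid n → Bool
isReduced {n} P =
  all (λ a → all (λ b → not (a <ᵇ b) ∨ (crossings P a b <ᵇ 2)) (upTo n)) (upTo n)

-- Slide moves.  slide P i is the paper's S_{i+1} (rows i, i+1, 0-indexed).

firstTrue : ∀ {m} → Vec Bool m → Maybe ℕ
firstTrue V.[] = nothing
firstTrue (true V.∷ xs) = just 0
firstTrue (false V.∷ xs) = Maybe.map suc (firstTrue xs)

lastTrue : ∀ {m} → Vec Bool m → Maybe ℕ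
lastTrue V.[] = nothing
lastTrue (x V.∷ xs) with lastTrue xs
... | just k = just (suc k)
... | nothing = if x then just 0 else nothing

slideCol : ∀ {n} → Grid n → ℕ → Maybe ℕ
slideCol P i with firstTrue (rowAt P i)
... | nothing = nothing
... | just zero = nothing
... | just (suc j) with lastTrue (rowAt P (suc i))
...   | nothing = just (suc j)
...   | just k = if k <ᵇ suc j then just (suc j) else nothing

slide : ∀ {n} → Grid n → ℕ → Grid n
slide P i with slideCol P i
... | nothing = P
... | just j = setCell (setCell P i j false) (suc i) (j ∸ 1) true

slideIndices : ℕ → List ℕ
slideIndices n = upTo (n ∸ 1)

isQuasiYam : ∀ {n} → Grid n → Bool
isQuasiYam {n} P = all (λ i → gridEq (slide P i) P) (slideIndices n)

inQPD0 : ∀ {n} → Permutation′ n → Grid n → Bool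
inQPD0 w Q = isPipeDream Q ∧ isReduced Q ∧ hasShape w Q ∧ isQuasiYam Q

-- Each move decreases the sum of
-- the column indices of the crosses, so n³ moves suffice.
firstMove : ∀ {n} → Grid n → List ℕ → Maybe (Grid n)
firstMove P [] = nothing
firstMove P (i ∷ is) = if gridEq (slide P i) P then firstMove P is else just (slide P i)

dstIter : ∀ {n} → ℕ → Grid n → Grid n
dstIter zero P = P
dstIter {n} (suc f) P with firstMove P (slideIndices n)
... | nothing = P
... | just P' = dstIter f P'

dst0 : ∀ {n} → Grid n → Grid n
dst0 {n} P = dstIter (n * n * n) P

-- A polynomial with ℕ coefficients is a
-- finite formal sum of monomials: a list of exponent vectors, two sums being
-- equal iff the lists are permutations of each other.

Monomial : ℕ → Set
Monomial n = Vec ℕ n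

Poly : ℕ → Set
Poly n = List (Monomial n)

_≈ₚ_ : ∀ {n} → Poly n → Poly n → Set
p ≈ₚ q = p ↭ q

countTrue : ∀ {m} → Vec Bool m → ℕ
countTrue V.[] = 0
countTrue (true V.∷ xs) = suc (countTrue xs)
countTrue (false V.∷ xs) = countTrue xs

xMon : ∀ {n} → Grid n → Monomial n
xMon P = V.map countTrue P

dst0Preimage : ∀ {n} → Permutation′ n → Grid n → List (Grid n)
dst0Preimage {n} w Q =
  filter (λ P → T? (isReduced P ∧ hasShape w P ∧ gridEq (dst0 P) Q)) (pipeDreams n)

slidePoly : ∀ {n} → Permutation′ n → Grid n → Poly n
slidePoly w Q = map xMon (dst0Preimage w Q)

-- The word Q_{0,n} and subword complexes.
-- Positions of Q_{0,n}: cells with r + c + 2 ≤ n, read right to left within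
-- a row, rows top to bottom; cell (r,c) carries the letter s_{r+c+1}.

positions : ℕ → List (ℕ × ℕ)
positions n = concatMap (λ r → map (λ c → (r , c)) (downFrom (n ∸ suc r))) (upTo n)

letter : ℕ × ℕ → ℕ
letter (r , c) = suc (r + c)

Q0word : ℕ → List ℕ
Q0word n = map letter (positions n)

word : ∀ {n} → Grid n → List ℕ
word {n} P = map letter (filter (λ rc → T? (crossAt P (proj₁ rc) (proj₂ rc))) (positions n))

-- The face Q_{0,n} ∖ word(P) (identified with P) lies in the slide complex
-- Δ̃(Q_{0,n}, S) iff the complement word(P) contains S as a subword.
inSlideComplex : ∀ {n} → List ℕ → Grid n → Bool
inSlideComplex S P = isPipeDream P ∧ does (S ⊆? word P)

-- crosses of P' ⊆ crosses of P  (i.e. face of P ⊆ face of P')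
crossSubset : ∀ {n} → Grid n → Grid n → Bool
crossSubset {n} P' P =
  all (λ rc → not (crossAt P' (proj₁ rc) (proj₂ rc)) ∨ crossAt P (proj₁ rc) (proj₂ rc)) (allCells n)

isFacet : ∀ {n} → List ℕ → Grid n → Bool
isFacet {n} S P =
  inSlideComplex S P ∧
  all (λ P' → not (inSlideComplex S P' ∧ crossSubset P' P ∧ not (gridEq P' P))) (pipeDreams n)

facets : ∀ {n} → List ℕ → List (Grid n)
facets {n} S = filter (λ P → T? (isFacet S P)) (pipeDreams n)

facetPoly : ∀ {n} → List ℕ → Poly n
facetPoly S = map xMon (facets S)

module Submission where

-- A face Q₀,ₙ ∖ word(P) of the slide complex is a facet exactly when word(P) = word(Q): if the
-- embedding of word(Q) into word(P) skips a letter, erasing that cross gives a larger face.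
-- So it suffices to show that a reduced pipe dream P of shape w has dst₀(P) = Q iff word(P) = word(Q).
-- A slide moves the last letter of row i (the cross at (i, j+1)) to the front of row i+1 (the cell
-- (i+1, j)), so it keeps the word. Since (i, j) and (i+1, j+1) are elbows, a strand entering the
-- 2 × 2 square at (i+1, j) leaves it at (i, j+1) in the same direction before and after the move,
-- so all strands keep their ends and their crossings: reducedness and shape are preserved.
-- A slide onto an existing cross cannot occur: in a reduced P the two strands through the square
-- would cross twice, and if word(P) = word(Q) the word would repeat a letter, which the word of a
-- quasi-Yamanouchi pipe dream never does.
-- Every slide moves a letter one row down, so dst₀ stops, at a quasi-Yamanouchi pipe dream; finally,
-- the word of a quasi-Yamanouchi pipe dream determines its rows, each non-empty row being a maximal
-- decreasing run of the word.

open import Defs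
open import Data.Bool using (Bool; true; false; _∧_; _∨_; not; T; if_then_else_)
open import Data.Bool.Properties using (T-≡; ∨-zeroʳ; ∧-identityʳ; ∧-zeroʳ)
open import Data.Empty using (⊥; ⊥-elim)
open import Data.Fin using (toℕ)
open import Data.Fin.Properties using (toℕ<n)
open import Data.Fin.Permutation using (Permutation′; _⟨$⟩ʳ_)
open import Data.List
  using (List; []; _∷_; _++_; _∷ʳ_; map; upTo; downFrom; filter; length; allFin; concat; concatMap; applyUpTo)
open import Data.List.Properties
  using ( filter-++; filter-accept; filter-reject; length-map; length-filter; length-downFrom; length-++
        ; length-applyUpTo; ++-assoc; ∷-injective; ∷-injectiveʳ; ∷-injectiveˡ; ∷ʳ-injective
        ; map-++; map-upTo; map-injective)
open import Data.List.Membership.Propositional using (_∈_)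
open import Data.List.Membership.Propositional.Properties
  using (∈-concat⁺′; ∈-map⁺; ∈-map⁻; ∈-upTo⁺; ∈-upTo⁻; ∈-downFrom⁺; ∈-++⁺ʳ; ∈-filter⁺; ∈-filter⁻)
open import Data.List.Relation.Binary.Disjoint.Propositional using (Disjoint)
open import Data.List.Relation.Binary.Equality.Propositional using (≋⇒≡)
open import Data.List.Relation.Binary.Permutation.Propositional using (↭-reflexive)
open import Data.List.Relation.Binary.Sublist.Propositional using (_⊆_; []; _∷_; ⊆-refl) renaming (_∷ʳ_ to skip)
open import Data.List.Relation.Binary.Sublist.Propositional.Properties using (length-mono-≤; to-≋)
open import Data.List.Relation.Unary.All as All using (All; []; _∷_)
import Data.List.Relation.Unary.All.Properties as All
open import Data.List.Relation.Unary.AllPairs as AllPairs using (AllPairs; []; _∷_)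
import Data.List.Relation.Unary.AllPairs.Properties as AllPairs
open import Data.List.Relation.Unary.Any using (here; there)
open import Data.List.Relation.Unary.Unique.Propositional using (Unique)
import Data.List.Relation.Unary.Unique.Propositional.Properties as Unique
open import Data.Maybe using (Maybe; just; nothing)
open import Data.Nat using (ℕ; zero; suc; _+_; _*_; _∸_; _<ᵇ_; _≡ᵇ_; _≤_; _<_; _>_; z≤n; s≤s)
open import Data.Nat.Properties
open import Data.List.Relation.Binary.Sublist.DecPropositional _≟_ using (_⊆?_)
open import Data.Product using (_×_; _,_; proj₁; proj₂; ∃-syntax)
open import Data.Product.Properties using (,-injectiveˡ; ,-injectiveʳ; ≡-dec)
open import Data.Sum using (_⊎_; inj₁; inj₂)
open import Data.Vec as V using (Vec)
open import Function using (_∘′_; case_of_)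
open import Function.Bundles using (Equivalence)
open import Relation.Binary.Definitions using (DecidableEquality; tri<; tri≈; tri>)
open import Relation.Binary.PropositionalEquality
open import Relation.Nullary using (¬_; Dec; does; yes; no)
open import Relation.Nullary.Decidable using (T?; dec-true)

Cell : Set
Cell = ℕ × ℕ

_≟ᶜ_ : DecidableEquality Cell
_≟ᶜ_ = ≡-dec _≟_ _≟_

false≢true : false ≢ true
false≢true ()

vat-vmod-≢ : ∀ {A : Set} {m} (d : A) (xs : Vec A m) {k k'} f → k ≢ k' → vat d (vmod xs k f) k' ≡ vat d xs k'
vat-vmod-≢ d V.[] f k≢k' = refl
vat-vmod-≢ d (x V.∷ xs) {zero} {zero} f k≢k' = ⊥-elim (k≢k' refl)
vat-vmod-≢ d (x V.∷ xs) {zero} {suc k'} f k≢k' = refl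
vat-vmod-≢ d (x V.∷ xs) {suc k} {zero} f k≢k' = refl
vat-vmod-≢ d (x V.∷ xs) {suc k} {suc k'} f k≢k' = vat-vmod-≢ d xs f (k≢k' ∘′ cong suc)

vat-vmod-≡ : ∀ {A : Set} {m} (d : A) (xs : Vec A m) {k} f → k < m → vat d (vmod xs k f) k ≡ f (vat d xs k)
vat-vmod-≡ d (x V.∷ xs) {zero} f _ = refl
vat-vmod-≡ d (x V.∷ xs) {suc k} f (s≤s k<m) = vat-vmod-≡ d xs f k<m

vat-≥ : ∀ {A : Set} {m} (d : A) (xs : Vec A m) {k} → m ≤ k → vat d xs k ≡ d
vat-≥ d V.[] _ = refl
vat-≥ d (x V.∷ xs) {suc k} (s≤s m≤k) = vat-≥ d xs m≤k

vmod-≥ : ∀ {A : Set} {m} (xs : Vec A m) {k} f → m ≤ k → vmod xs k f ≡ xs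
vmod-≥ V.[] f _ = refl
vmod-≥ (x V.∷ xs) {suc k} f (s≤s m≤k) = cong (x V.∷_) (vmod-≥ xs f m≤k)

vat-map : ∀ {A B : Set} {m} (g : A → B) (d : A) (xs : Vec A m) k → vat (g d) (V.map g xs) k ≡ g (vat d xs k)
vat-map g d V.[] k = refl
vat-map g d (x V.∷ xs) zero = refl
vat-map g d (x V.∷ xs) (suc k) = vat-map g d xs k

vat-replicate : ∀ {A : Set} m (d : A) k → vat d (V.replicate m d) k ≡ d
vat-replicate zero d k = refl
vat-replicate (suc m) d zero = refl
vat-replicate (suc m) d (suc k) = vat-replicate m d k

vat≡true⇒< : ∀ {m} (xs : Vec Bool m) {k} → vat false xs k ≡ true → k < m
vat≡true⇒< (x V.∷ xs) {zero} _ = s≤s z≤n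
vat≡true⇒< (x V.∷ xs) {suc k} e = s≤s (vat≡true⇒< xs e)

vec-ext : ∀ {A : Set} {m} (d : A) (xs ys : Vec A m) → (∀ k → k < m → vat d xs k ≡ vat d ys k) → xs ≡ ys
vec-ext d V.[] V.[] h = refl
vec-ext d (x V.∷ xs) (y V.∷ ys) h = cong₂ V._∷_ (h 0 (s≤s z≤n)) (vec-ext d xs ys (λ k k<m → h (suc k) (s≤s k<m)))

crossAt-rowAt : ∀ {n} (P : Grid n) r c → crossAt P r c ≡ vat false (rowAt P r) c
crossAt-rowAt {n} P r c = begin
  vat false (V.map (λ row → vat false row c) P) r
    ≡⟨ cong (λ z → vat z (V.map (λ row → vat false row c) P) r) (sym (vat-replicate n false c)) ⟩
  vat (vat false (V.replicate n false) c) (V.map (λ row → vat false row c) P) r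
    ≡⟨ vat-map (λ row → vat false row c) (V.replicate n false) P r ⟩
  vat false (rowAt P r) c ∎
  where open ≡-Reasoning

crossAt-bounded : ∀ {n} (P : Grid n) {r c} → crossAt P r c ≡ true → r < n × c < n
crossAt-bounded {n} P {r} {c} cross with n ≤? r
... | yes n≤r = ⊥-elim (false≢true (begin
      false                                     ≡⟨ sym (vat-replicate n false c) ⟩
      vat false (V.replicate n false) c         ≡⟨ cong (λ row → vat false row c) (sym (vat-≥ _ P n≤r)) ⟩
      vat false (rowAt P r) c                   ≡⟨ sym (crossAt-rowAt P r c) ⟩
      crossAt P r c                             ≡⟨ cross ⟩
      true                                      ∎))
  where open ≡-Reasoning
... | no n≰r = ≰⇒> n≰r , vat≡true⇒< (rowAt P r) (trans (sym (crossAt-rowAt P r c)) cross)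

grid-ext : ∀ {n} (P Q : Grid n) → (∀ r c → r < n → c < n → crossAt P r c ≡ crossAt Q r c) → P ≡ Q
grid-ext {n} P Q same = vec-ext (V.replicate n false) P Q λ r r<n → vec-ext false (rowAt P r) (rowAt Q r) λ c c<n →
  trans (sym (crossAt-rowAt P r c)) (trans (same r c r<n c<n) (crossAt-rowAt Q r c))

cross≢elbow : ∀ {n} (P : Grid n) {r c r' c'} → crossAt P r c ≡ true → crossAt P r' c' ≡ false → (r , c) ≢ (r' , c')
cross≢elbow P cross elbow refl = false≢true (trans (sym elbow) cross)

crossAt-setCell-≢ : ∀ {n} (P : Grid n) {r c} b {r' c'} → (r , c) ≢ (r' , c') →
                    crossAt (setCell P r c b) r' c' ≡ crossAt P r' c'
crossAt-setCell-≢ {n} P {r} {c} b {r'} {c'} cell≢ with r ≟ r'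
... | no r≢r' = begin
      crossAt (setCell P r c b) r' c'           ≡⟨ crossAt-rowAt (setCell P r c b) r' c' ⟩
      vat false (rowAt (setCell P r c b) r') c' ≡⟨ cong (λ row → vat false row c') (vat-vmod-≢ _ P _ r≢r') ⟩
      vat false (rowAt P r') c'                 ≡⟨ sym (crossAt-rowAt P r' c') ⟩
      crossAt P r' c'                           ∎
  where open ≡-Reasoning
... | yes refl with n ≤? r
...   | yes n≤r = cong (λ G → crossAt G r c') (vmod-≥ P _ n≤r)
...   | no n≰r = begin
      crossAt (setCell P r c b) r c'            ≡⟨ crossAt-rowAt (setCell P r c b) r c' ⟩
      vat false (rowAt (setCell P r c b) r) c'  ≡⟨ cong (λ row → vat false row c') (vat-vmod-≡ _ P _ (≰⇒> n≰r)) ⟩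
      vat false (vmod (rowAt P r) c _) c'       ≡⟨ vat-vmod-≢ false (rowAt P r) _ (cell≢ ∘′ cong (r ,_)) ⟩
      vat false (rowAt P r) c'                  ≡⟨ sym (crossAt-rowAt P r c') ⟩
      crossAt P r c'                            ∎
  where open ≡-Reasoning

crossAt-setCell-≡ : ∀ {n} (P : Grid n) {r c} b → r < n → c < n → crossAt (setCell P r c b) r c ≡ b
crossAt-setCell-≡ {n} P {r} {c} b r<n c<n = begin
  crossAt (setCell P r c b) r c             ≡⟨ crossAt-rowAt (setCell P r c b) r c ⟩
  vat false (rowAt (setCell P r c b) r) c   ≡⟨ cong (λ row → vat false row c) (vat-vmod-≡ _ P _ r<n) ⟩
  vat false (vmod (rowAt P r) c _) c        ≡⟨ vat-vmod-≡ false (rowAt P r) _ c<n ⟩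
  b                                         ∎
  where open ≡-Reasoning

∧≡true⁻ : ∀ {a b} → a ∧ b ≡ true → a ≡ true × b ≡ true
∧≡true⁻ {true} b≡true = refl , b≡true

not-∨-elim : ∀ {a b} → not a ∨ b ≡ true → a ≡ true → b ≡ true
not-∨-elim {true} b≡true refl = b≡true

not-∨-intro : ∀ {a b} → (a ≡ true → b ≡ true) → not a ∨ b ≡ true
not-∨-intro {true} imp = imp refl
not-∨-intro {false} imp = refl

all-∈ : ∀ {A : Set} (p : A → Bool) {xs x} → all p xs ≡ true → x ∈ xs → p x ≡ true
all-∈ p {y ∷ xs} holds (here refl) = proj₁ (∧≡true⁻ holds)
all-∈ p {y ∷ xs} holds (there x∈xs) = all-∈ p (proj₂ (∧≡true⁻ {p y} holds)) x∈xs

all-intro : ∀ {A : Set} (p : A → Bool) xs → (∀ x → x ∈ xs → p x ≡ true) → all p xs ≡ true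
all-intro p [] holds = refl
all-intro p (x ∷ xs) holds rewrite holds x (here refl) = all-intro p xs (λ y y∈xs → holds y (there y∈xs))

all-cong : ∀ {A : Set} (p q : A → Bool) xs → (∀ x → x ∈ xs → p x ≡ q x) → all p xs ≡ all q xs
all-cong p q [] same = refl
all-cong p q (x ∷ xs) same = cong₂ _∧_ (same x (here refl)) (all-cong p q xs (λ y y∈xs → same y (there y∈xs)))

∈-allCells : ∀ {n r c} → r < n → c < n → (r , c) ∈ allCells n
∈-allCells {n} {r} r<n c<n =
  ∈-concat⁺′ (∈-map⁺ (r ,_) (∈-upTo⁺ c<n)) (∈-map⁺ (λ r → map (r ,_) (upTo n)) (∈-upTo⁺ r<n))

pd⇒above-antidiagonal : ∀ {n} (P : Grid n) → isPipeDream P ≡ true → ∀ r c → crossAt P r c ≡ true → suc (r + c) < n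
pd⇒above-antidiagonal P pd r c cross with crossAt-bounded P cross
... | r<n , c<n = <ᵇ⇒< _ _ (Equivalence.from T-≡ (not-∨-elim (all-∈ _ pd (∈-allCells r<n c<n)) cross))

above-antidiagonal⇒pd : ∀ {n} (P : Grid n) → (∀ {r c} → crossAt P r c ≡ true → suc (r + c) < n) → isPipeDream P ≡ true
above-antidiagonal⇒pd {n} P above = all-intro _ (allCells n) λ _ _ →
  not-∨-intro λ cross → Equivalence.to T-≡ (<⇒<ᵇ (above cross))

bit : Bool → ℕ
bit true = 1
bit false = 0

filterᵇ : ∀ {A : Set} → (A → Bool) → List A → List A
filterᵇ p = filter (λ x → T? (p x))

countᵇ : ∀ {A : Set} → (A → Bool) → List A → ℕ
countᵇ p xs = length (filterᵇ p xs)

countᵇ-∷ : ∀ {A : Set} (p : A → Bool) x xs → countᵇ p (x ∷ xs) ≡ bit (p x) + countᵇ p xs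
countᵇ-∷ p x xs with p x
... | true = refl
... | false = refl

countᵇ-++ : ∀ {A : Set} (p : A → Bool) xs ys → countᵇ p (xs ++ ys) ≡ countᵇ p xs + countᵇ p ys
countᵇ-++ p xs ys = trans (cong length (filter-++ (λ x → T? (p x)) xs ys)) (length-++ (filter _ xs))

State : Set
State = ℕ × ℕ × Dir

north : ℕ → ℕ → Maybe State
north zero c = nothing
north (suc r) c = just (r , c , fromSouth)

move : ℕ → ℕ → Bool → Dir → Maybe State
move r c true fromWest = just (r , suc c , fromWest)
move r c false fromSouth = just (r , suc c , fromWest)
move r c true fromSouth = north r c
move r c false fromWest = north r c

next : ∀ {n} → Grid n → State → Maybe State
next P (r , c , d) = move r c (crossAt P r c) d

Walk : Set
Walk = List Cell × ℕ

walkFrom : ∀ {n} → Grid n → ℕ → State → Walk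
walkFrom P f (r , c , d) = walk P f r c d

walkOn : ∀ {n} → Grid n → ℕ → ℕ → Maybe State → Walk
walkOn P f c nothing = [] , c
walkOn P f c (just s) = walkFrom P f s

visit : Cell → Walk → Walk
visit x (cs , e) = (x ∷ cs) , e

walk-step : ∀ {n} (P : Grid n) f r c d → walk P (suc f) r c d ≡ visit (r , c) (walkOn P f c (next P (r , c , d)))
walk-step P f r c d with crossAt P r c
walk-step P f r c fromWest | true = refl
walk-step P f r c fromSouth | false = refl
walk-step P f zero c fromSouth | true = refl
walk-step P f (suc r) c fromSouth | true = refl
walk-step P f zero c fromWest | false = refl
walk-step P f (suc r) c fromWest | false = refl

data MoveView (r c : ℕ) (b : Bool) (d : Dir) : State → Set where
  east : (b ≡ true × d ≡ fromWest) ⊎ (b ≡ false × d ≡ fromSouth) → MoveView r c b d (r , suc c , fromWest)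
  up : ∀ {r'} → r ≡ suc r' → (b ≡ true × d ≡ fromSouth) ⊎ (b ≡ false × d ≡ fromWest) → MoveView r c b d (r' , c , fromSouth)

move-view : ∀ r c b d {s} → move r c b d ≡ just s → MoveView r c b d s
move-view r c true fromWest refl = east (inj₁ (refl , refl))
move-view r c false fromSouth refl = east (inj₂ (refl , refl))
move-view (suc r) c true fromSouth refl = up refl (inj₁ (refl , refl))
move-view (suc r) c false fromWest refl = up refl (inj₂ (refl , refl))

steps-move : ∀ r c b d {t L a} → move r c b d ≡ just t → L + r ≡ a + c → suc L + proj₁ t ≡ a + proj₁ (proj₂ t)
steps-move r c b d {L = L} {a} eq steps with move-view r c b d eq
... | east _ = trans (cong suc steps) (sym (+-suc a c))
... | up refl _ = trans (sym (+-suc L _)) steps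

walk-via : ∀ {n} (P : Grid n) f {r c d m} → next P (r , c , d) ≡ m → walk P (suc f) r c d ≡ visit (r , c) (walkOn P f c m)
walk-via P f {r} {c} {d} eq = trans (walk-step P f r c d) (cong (λ m → visit (r , c) (walkOn P f c m)) eq)

-- A walk at (r , c) with fuel f and n + r ≤ f + c cannot run out of fuel inside the grid.
fuel-east : ∀ n r f c → n + r ≤ suc f + c → n + r ≤ f + suc c
fuel-east n r f c le = ≤-trans le (≤-reflexive (sym (+-suc f c)))

fuel-north : ∀ n r f c → n + suc r ≤ suc f + c → n + r ≤ f + c
fuel-north n r f c le = ≤-pred (≤-trans (≤-reflexive (sym (+-suc n r))) le)

fuel-move : ∀ n r c b d f {t} → move r c b d ≡ just t → n + r ≤ suc f + c → n + proj₁ t ≤ f + proj₁ (proj₂ t)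
fuel-move n r c b d f eq fuel with move-view r c b d eq
... | east _ = fuel-east n r f c fuel
... | up refl _ = fuel-north n _ f c fuel

-- Strands through a 2 × 2 block

module Block (i j : ℕ) where

  A C D E : Cell
  A = (suc i , j)
  C = (i , j)
  D = (i , suc j)
  E = (suc i , suc j)

  record Antidiagonal {n : ℕ} (G : Grid n) (x : Bool) : Set where
    field
      at-A : crossAt G (suc i) j ≡ x
      at-D : crossAt G i (suc j) ≡ not x
      at-C : crossAt G i j ≡ false
      at-E : crossAt G (suc i) (suc j) ≡ false

  -- With elbows at C and E, these states can only be reached by passing through A.
  data Inner : State → Set where
    in-C : Inner (i , j , fromSouth)
    in-E : Inner (suc i , suc j , fromWest)
    in-D-west : Inner (i , suc j , fromWest)
    in-D-south : Inner (i , suc j , fromSouth)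

  inner-D : ∀ {d} → Inner (i , suc j , d)
  inner-D {fromWest} = in-D-west
  inner-D {fromSouth} = in-D-south

  inner-row : ∀ {r c d} → Inner (r , c , d) → r ≡ i ⊎ r ≡ suc i
  inner-row in-C = inj₁ refl
  inner-row in-E = inj₂ refl
  inner-row in-D-west = inj₁ refl
  inner-row in-D-south = inj₁ refl

  A≢D : A ≢ D
  A≢D eq = 1+n≢n (,-injectiveˡ eq)

  C≢A : C ≢ A
  C≢A eq = 1+n≢n (sym (,-injectiveˡ eq))

  C≢D : C ≢ D
  C≢D eq = 1+n≢n (sym (,-injectiveʳ eq))

  E≢A : E ≢ A
  E≢A eq = 1+n≢n (,-injectiveʳ eq)

  E≢D : E ≢ D
  E≢D eq = 1+n≢n (,-injectiveˡ eq)

  countᵇ-block : ∀ (q : Cell → Bool) m {a b c} → q A ≡ a → q m ≡ b → q D ≡ c →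
                 countᵇ q (A ∷ m ∷ D ∷ []) ≡ bit a + (bit b + bit c)
  countᵇ-block q m refl refl refl =
    trans (countᵇ-∷ q A _) (cong (bit (q A) +_) (trans (countᵇ-∷ q m _) (cong (bit (q m) +_) (trans (countᵇ-∷ q D []) (+-identityʳ _)))))

  middleWest middleSouth : Bool → Cell
  middleWest x = if x then E else C
  middleSouth x = if x then C else E

  module _ {n : ℕ} {G : Grid n} where
    open Antidiagonal

    -- Wherever the cross of the antidiagonal sits, the strand leaves through D as it entered A.
    through-west : ∀ x → Antidiagonal G x → ∀ f → walk G (3 + f) (suc i) j fromWest ≡
                   visit A (visit (middleWest x) (visit D (walk G f i (suc (suc j)) fromWest)))
    through-west true blk f =
      trans (walk-via G _ (cong (λ b → move _ _ b fromWest) (at-A blk)))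
      (cong (visit A) (trans (walk-via G _ (cong (λ b → move _ _ b fromWest) (at-E blk)))
      (cong (visit E) (walk-via G _ (cong (λ b → move _ _ b fromSouth) (at-D blk))))))
    through-west false blk f =
      trans (walk-via G _ (cong (λ b → move _ _ b fromWest) (at-A blk)))
      (cong (visit A) (trans (walk-via G _ (cong (λ b → move _ _ b fromSouth) (at-C blk)))
      (cong (visit C) (walk-via G _ (cong (λ b → move _ _ b fromWest) (at-D blk))))))

    through-south : ∀ x → Antidiagonal G x → ∀ f → walk G (3 + f) (suc i) j fromSouth ≡
                    visit A (visit (middleSouth x) (visit D (walkOn G f (suc j) (north i (suc j)))))
    through-south true blk f =
      trans (walk-via G _ (cong (λ b → move _ _ b fromSouth) (at-A blk)))
      (cong (visit A) (trans (walk-via G _ (cong (λ b → move _ _ b fromSouth) (at-C blk)))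
      (cong (visit C) (walk-via G _ (cong (λ b → move _ _ b fromWest) (at-D blk))))))
    through-south false blk f =
      trans (walk-via G _ (cong (λ b → move _ _ b fromSouth) (at-A blk)))
      (cong (visit A) (trans (walk-via G _ (cong (λ b → move _ _ b fromWest) (at-E blk)))
      (cong (visit E) (walk-via G _ (cong (λ b → move _ _ b fromSouth) (at-D blk))))))

    enter-inner : crossAt G i j ≡ false → crossAt G (suc i) (suc j) ≡ false →
                  ∀ {s t} → next G s ≡ just t → Inner t → (proj₁ s , proj₁ (proj₂ s)) ≡ A ⊎ Inner s
    enter-inner elbow-C elbow-E {r , c , d} eq inner with move-view r c (crossAt G r c) d eq | inner
    ... | east _ | in-E = inj₁ refl
    ... | east (inj₁ (cross , _)) | in-D-west = ⊥-elim (false≢true (trans (sym elbow-C) cross))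
    ... | east (inj₂ (_ , refl)) | in-D-west = inj₂ in-C
    ... | up refl _ | in-C = inj₁ refl
    ... | up refl (inj₁ (cross , _)) | in-D-south = ⊥-elim (false≢true (trans (sym elbow-E) cross))
    ... | up refl (inj₂ (_ , refl)) | in-D-south = inj₂ in-E

  fuel-for-block : ∀ {n f} → i + j + 3 ≤ n → n + suc i ≤ f + j → 3 ≤ f
  fuel-for-block {n} {f} room fuel = +-cancelʳ-≤ j 3 f (begin
    3 + j        ≡⟨ +-comm 3 j ⟩
    j + 3        ≤⟨ m≤n+m (j + 3) i ⟩
    i + (j + 3)  ≡⟨ sym (+-assoc i j 3) ⟩
    i + j + 3    ≤⟨ room ⟩
    n            ≤⟨ m≤m+n n (suc i) ⟩
    n + suc i    ≤⟨ fuel ⟩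
    f + j        ∎)
    where open ≤-Reasoning

  block-fits : ∀ {n} (P : Grid n) → isPipeDream P ≡ true → crossAt P i (suc j) ≡ true → i + j + 3 ≤ n
  block-fits P pd cross-D = ≤-trans (≤-reflexive (trans (+-comm (i + j) 3) (cong (λ k → suc (suc k)) (sym (+-suc i j)))))
                                      (pd⇒above-antidiagonal P pd i (suc j) cross-D)

  -- Two grids that differ only on the antidiagonal of the block have the same strands up to the
  -- traversal of the block; p and p' are any statistics of the cells visited that this cannot tell apart.
  module Simulation {n : ℕ} (G G' : Grid n) (room : i + j + 3 ≤ n) {x x' : Bool}
    (blk : Antidiagonal G x) (blk' : Antidiagonal G' x')
    (agree : ∀ {r c} → (r , c) ≢ A → (r , c) ≢ D → crossAt G r c ≡ crossAt G' r c)
    (p p' : Cell → Bool)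
    (p-agree : ∀ {y} → y ≢ A → y ≢ D → p y ≡ p' y)
    (p-west : countᵇ p (A ∷ middleWest x ∷ D ∷ []) ≡ countᵇ p' (A ∷ middleWest x' ∷ D ∷ []))
    (p-south : countᵇ p (A ∷ middleSouth x ∷ D ∷ []) ≡ countᵇ p' (A ∷ middleSouth x' ∷ D ∷ [])) where

    open Antidiagonal

    Related : Walk → Walk → Set
    Related (xs , e) (ys , e') = countᵇ p xs ≡ countᵇ p' ys × e ≡ e'

    related-visit : ∀ y {w w'} → p y ≡ p' y → Related w w' → Related (visit y w) (visit y w')
    related-visit y {xs , _} {ys , _} same (counts , exits) =
      trans (countᵇ-∷ p y xs) (trans (cong₂ _+_ (cong bit same) counts) (sym (countᵇ-∷ p' y ys))) , exits

    related-block : ∀ m m' {w w'} → countᵇ p (A ∷ m ∷ D ∷ []) ≡ countᵇ p' (A ∷ m' ∷ D ∷ []) → Related w w' →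
                    Related (visit A (visit m (visit D w))) (visit A (visit m' (visit D w')))
    related-block m m' {xs , _} {ys , _} block (counts , exits) =
      trans (countᵇ-++ p (A ∷ m ∷ D ∷ []) xs) (trans (cong₂ _+_ block counts) (sym (countᵇ-++ p' (A ∷ m' ∷ D ∷ []) ys))) ,
      exits

    not-inner-above : ∀ {r c d} → r < i → ¬ Inner (r , c , d)
    not-inner-above above inner with inner-row inner
    ... | inj₁ refl = <-irrefl refl above
    ... | inj₂ refl = <-asym above (n<1+n _)

    mutual
      simulate : ∀ f s → ¬ Inner s → n + proj₁ s ≤ f + proj₁ (proj₂ s) → Related (walkFrom G f s) (walkFrom G' f s)
      simulate zero s _ _ = refl , refl
      simulate (suc f) (r , c , d) outside fuel with (r , c) ≟ᶜ A
      ... | yes refl = simulate-A f d fuel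
      ... | no ≢A = simulate-outside f r c d outside fuel ≢A

      simulate-A : ∀ f d → n + suc i ≤ suc f + j → Related (walk G (suc f) (suc i) j d) (walk G' (suc f) (suc i) j d)
      simulate-A zero d fuel with fuel-for-block room fuel
      ... | s≤s ()
      simulate-A (suc zero) d fuel with fuel-for-block room fuel
      ... | s≤s (s≤s ())
      simulate-A (suc (suc f)) fromWest fuel =
        subst₂ Related (sym (through-west x blk f)) (sym (through-west x' blk' f))
          (related-block _ _ p-west (simulate f (i , suc (suc j) , fromWest) (λ ())
            (fuel-east n i f (suc j) (fuel-east n i (suc f) j (fuel-north n i (suc (suc f)) j fuel)))))
      simulate-A (suc (suc f)) fromSouth fuel =
        subst₂ Related (sym (through-south x blk f)) (sym (through-south x' blk' f))
          (related-block _ _ p-south (simulate-north f i (suc j) ≤-refl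
            (fuel-east n i (suc f) j (fuel-north n i (suc (suc f)) j fuel))))

      simulate-north : ∀ f r c → r ≤ i → n + r ≤ suc f + c → Related (walkOn G f c (north r c)) (walkOn G' f c (north r c))
      simulate-north f zero c _ _ = refl , refl
      simulate-north f (suc r) c r<i fuel = simulate f (r , c , fromSouth) (not-inner-above r<i) (fuel-north n r f c fuel)

      simulate-outside : ∀ f r c d → ¬ Inner (r , c , d) → n + r ≤ suc f + c → (r , c) ≢ A →
                         Related (walk G (suc f) r c d) (walk G' (suc f) r c d)
      simulate-outside f r c d outside fuel ≢A =
        subst₂ Related (sym (walk-step G f r c d)) (sym (walk-step G' f r c d))
          (related-visit (r , c) (p-agree ≢A ≢D)
            (subst (λ m → Related (walkOn G f c m) (walkOn G' f c (next G' (r , c , d)))) (sym same-next)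
              (continue _ refl)))
        where
        ≢D : (r , c) ≢ D
        ≢D refl = outside inner-D
        same-next : next G (r , c , d) ≡ next G' (r , c , d)
        same-next = cong (λ b → move r c b d) (agree ≢A ≢D)
        continue : ∀ m → next G' (r , c , d) ≡ m → Related (walkOn G f c m) (walkOn G' f c m)
        continue nothing _ = refl , refl
        continue (just t) eq = simulate f t outside-t (fuel-move n r c (crossAt G' r c) d f eq fuel)
          where
          outside-t : ¬ Inner t
          outside-t inner with enter-inner {G = G} (at-C blk) (at-E blk) (trans same-next eq) inner
          ... | inj₁ at-A = ≢A at-A
          ... | inj₂ inner-s = outside inner-s

    strand-related : ∀ a → a < n → Related (strand G a) (strand G' a)
    strand-related a a<n = simulate (n + n) (a , 0 , fromWest) (λ ())
      (≤-trans (+-monoʳ-≤ n (<⇒≤ a<n)) (≤-reflexive (sym (+-identityʳ (n + n)))))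

-- The states a strand of a pipe dream can occupy; from each of them the strand can be traced back.
Admissible : ℕ → State → Set
Admissible n (r , c , fromWest) = r + c < n
Admissible n (r , c , fromSouth) = suc (r + c) < n

record OnStrand {n : ℕ} (P : Grid n) (s : State) : Set where
  field
    start : ℕ
    start<n : start < n
    before : List Cell
    fuel : ℕ
    path : strandPath P start ≡ before ++ proj₁ (walkFrom P fuel s)
    enough : n + proj₁ s ≤ fuel + proj₁ (proj₂ s)
    steps : length before + proj₁ s ≡ start + proj₁ (proj₂ s)

module _ {n : ℕ} (P : Grid n) (pd : isPipeDream P ≡ true) where

  admissible-col : ∀ r c d → Admissible n (r , c , d) → c < n
  admissible-col r c fromWest adm = ≤-trans (s≤s (m≤n+m c r)) adm
  admissible-col r c fromSouth adm = ≤-trans (s≤s (m≤n+m c r)) (<⇒≤ adm)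

  admissible-row : ∀ r c d → Admissible n (r , c , d) → r < n
  admissible-row r c fromWest adm = ≤-trans (s≤s (m≤m+n r c)) adm
  admissible-row r c fromSouth adm = ≤-trans (s≤s (m≤m+n r c)) (<⇒≤ adm)

  on-strand-next : ∀ {s t} → next P s ≡ just t → Admissible n s → OnStrand P s → OnStrand P t
  on-strand-next {r , c , d} eq adm record { fuel = zero ; enough = enough } =
    ⊥-elim (<⇒≱ (admissible-col r c d adm) (≤-trans (m≤m+n n r) enough))
  on-strand-next {r , c , d} {t} eq adm on@record { fuel = suc f } = record
    { start = start
    ; start<n = start<n
    ; before = before ++ ((r , c) ∷ [])
    ; fuel = f
    ; path = trans path (trans (cong (λ w → before ++ proj₁ w) (walk-via P f eq)) (sym (++-assoc before _ _)))
    ; enough = fuel-move n r c (crossAt P r c) d f eq enough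
    ; steps = trans (cong (_+ proj₁ t) (trans (length-++ before) (+-comm _ 1))) (steps-move r c (crossAt P r c) d eq steps)
    }
    where open OnStrand on

  -- k = n + c ∸ r decreases as the strand is traced back west or south.
  on-strand : ∀ k r c d → k + r ≡ n + c → Admissible n (r , c , d) → OnStrand P (r , c , d)
  on-strand zero r c d k+r adm =
    ⊥-elim (<⇒≱ (admissible-row r c d adm) (≤-trans (m≤m+n n c) (≤-reflexive (sym k+r))))
  on-strand (suc k) r zero fromWest _ adm = record
    { start = r ; start<n = r<n ; before = [] ; fuel = n + n ; path = refl
    ; enough = ≤-trans (+-monoʳ-≤ n (<⇒≤ r<n)) (≤-reflexive (sym (+-identityʳ (n + n))))
    ; steps = sym (+-identityʳ r) }
    where r<n = admissible-row r zero fromWest adm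
  on-strand (suc k) r (suc c) fromWest k+r adm with crossAt P r c in cross
  ... | true = on-strand-next (cong (λ b → move r c b fromWest) cross) adm'
                 (on-strand k r c fromWest k+r' adm')
    where
    adm' = ≤-trans (≤-reflexive (sym (+-suc r c))) (<⇒≤ adm)
    k+r' = suc-injective (trans k+r (+-suc n c))
  ... | false = on-strand-next (cong (λ b → move r c b fromSouth) cross) adm'
                  (on-strand k r c fromSouth k+r' adm')
    where
    adm' = ≤-trans (s≤s (≤-reflexive (sym (+-suc r c)))) adm
    k+r' = suc-injective (trans k+r (+-suc n c))
  on-strand (suc k) r c fromSouth k+r adm with crossAt P (suc r) c in cross
  ... | true = on-strand-next (cong (λ b → move (suc r) c b fromSouth) cross) adm'
                 (on-strand k (suc r) c fromSouth (trans (+-suc k r) k+r) adm')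
    where adm' = pd⇒above-antidiagonal P pd (suc r) c cross
  ... | false = on-strand-next (cong (λ b → move (suc r) c b fromWest) cross) adm
                  (on-strand k (suc r) c fromWest (trans (+-suc k r) k+r) adm)

cellEq-≡ : ∀ x y → cellEq x y ≡ true → x ≡ y
cellEq-≡ (a , b) (c , d) same with ∧≡true⁻ {a ≡ᵇ c} same
... | a≡c , b≡d = cong₂ _,_ (≡ᵇ⇒≡ a c (Equivalence.from T-≡ a≡c)) (≡ᵇ⇒≡ b d (Equivalence.from T-≡ b≡d))

cellEq-≢ : ∀ x y → x ≢ y → cellEq x y ≡ false
cellEq-≢ x y x≢y with cellEq x y in same
... | true = ⊥-elim (x≢y (cellEq-≡ x y same))
... | false = refl

cellEq-refl : ∀ x → cellEq x x ≡ true
cellEq-refl (a , b) = cong₂ _∧_ (≡ᵇ-refl a) (≡ᵇ-refl b)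
  where ≡ᵇ-refl = λ m → Equivalence.to T-≡ (≡⇒≡ᵇ m m refl)

elemCell-∈ : ∀ {x ys} → x ∈ ys → elemCell x ys ≡ true
elemCell-∈ {x} (here refl) rewrite cellEq-refl x = refl
elemCell-∈ {x} {y ∷ ys} (there x∈ys) rewrite elemCell-∈ x∈ys = ∨-zeroʳ (cellEq x y)

++-cancel-length : ∀ {A : Set} (xs ys : List A) {us vs} → length xs ≡ length ys → xs ++ us ≡ ys ++ vs → us ≡ vs
++-cancel-length [] [] _ eq = eq
++-cancel-length (x ∷ xs) (y ∷ ys) lengths eq = ++-cancel-length xs ys (suc-injective lengths) (∷-injectiveʳ eq)

reduced⇒crossings<2 : ∀ {n} (P : Grid n) → isReduced P ≡ true → ∀ {a b} → a < b → b < n → crossings P a b < 2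
reduced⇒crossings<2 {n} P red {a} {b} a<b b<n =
  <ᵇ⇒< _ _ (Equivalence.from T-≡ (not-∨-elim (all-∈ _ (all-∈ _ red (∈-upTo⁺ (<-trans a<b b<n))) (∈-upTo⁺ b<n))
                                              (Equivalence.to T-≡ (<⇒<ᵇ a<b))))

countᵇ-≥2 : ∀ {A : Set} (q : A → Bool) xs x y z zs → q x ≡ true → q z ≡ true → 2 ≤ countᵇ q (xs ++ x ∷ y ∷ z ∷ zs)
countᵇ-≥2 q xs x y z zs qx qz = begin
  2                                                    ≤⟨ s≤s (≤-trans (s≤s z≤n) (m≤n+m _ (bit (q y)))) ⟩
  bit true + (bit (q y) + (bit true + countᵇ q zs))    ≡⟨ cong₂ (λ bx bz → bit bx + (bit (q y) + (bit bz + countᵇ q zs))) (sym qx) (sym qz) ⟩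
  bit (q x) + (bit (q y) + (bit (q z) + countᵇ q zs))  ≡⟨ cong (λ k → bit (q x) + (bit (q y) + k)) (sym (countᵇ-∷ q z zs)) ⟩
  bit (q x) + (bit (q y) + countᵇ q (z ∷ zs))          ≡⟨ sym (cong (bit (q x) +_) (countᵇ-∷ q y (z ∷ zs))) ⟩
  bit (q x) + countᵇ q (y ∷ z ∷ zs)                    ≡⟨ sym (countᵇ-∷ q x (y ∷ z ∷ zs)) ⟩
  countᵇ q (x ∷ y ∷ z ∷ zs)                            ≤⟨ m≤n+m _ (countᵇ q xs) ⟩
  countᵇ q xs + countᵇ q (x ∷ y ∷ z ∷ zs)              ≡⟨ sym (countᵇ-++ q xs (x ∷ y ∷ z ∷ zs)) ⟩
  countᵇ q (xs ++ x ∷ y ∷ z ∷ zs)                      ∎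
  where open ≤-Reasoning

module _ {n : ℕ} (P : Grid n) (pd : isPipeDream P ≡ true) (red : isReduced P ≡ true) (i j : ℕ)
  (cross-A : crossAt P (suc i) j ≡ true) (cross-D : crossAt P i (suc j) ≡ true)
  (elbow-C : crossAt P i j ≡ false) (elbow-E : crossAt P (suc i) (suc j) ≡ false) where

  open Block i j

  private
    room : i + j + 3 ≤ n
    room = block-fits P pd cross-D

    record Through (m : Cell) : Set where
      field
        start : ℕ
        start<n : start < n
        before : List Cell
        rest : List Cell
        path : strandPath P start ≡ before ++ A ∷ m ∷ D ∷ rest
        steps : length before + suc i ≡ start + j

    through : ∀ {d m} → (∀ f → ∃[ rest ] proj₁ (walk P (3 + f) (suc i) j d) ≡ A ∷ m ∷ D ∷ rest) →
              OnStrand P (suc i , j , d) → Through m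
    through block record { start = a ; start<n = a<n ; before = bs ; fuel = f ; path = path ; enough = enough ; steps = steps }
      with fuel-for-block room enough
    ... | s≤s (s≤s (s≤s {n = f'} _)) = record
      { start = a ; start<n = a<n ; before = bs ; rest = proj₁ (block f')
      ; path = trans path (cong (bs ++_) (proj₂ (block f'))) ; steps = steps }

    on-strand-A : ∀ d → Admissible n (suc i , j , d) → OnStrand P (suc i , j , d)
    on-strand-A d = on-strand P pd (n + j ∸ suc i) (suc i) j d (m∸n+n≡m (≤-trans (<⇒≤ suc-i<n) (m≤m+n n j)))
      where suc-i<n = ≤-trans (s≤s (m≤m+n (suc i) j)) (<⇒≤ (pd⇒above-antidiagonal P pd (suc i) j cross-A))

    strand-from-west : Through E
    strand-from-west = through (λ f → _ , cong proj₁
      (trans (walk-via P _ (cong (λ b → move _ _ b fromWest) cross-A))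
      (cong (visit A) (trans (walk-via P _ (cong (λ b → move _ _ b fromWest) elbow-E))
      (cong (visit E) (walk-via P _ (cong (λ b → move _ _ b fromSouth) cross-D)))))))
      (on-strand-A fromWest (<⇒≤ (pd⇒above-antidiagonal P pd (suc i) j cross-A)))

    strand-from-south : Through C
    strand-from-south = through (λ f → _ , cong proj₁
      (trans (walk-via P _ (cong (λ b → move _ _ b fromSouth) cross-A))
      (cong (visit A) (trans (walk-via P _ (cong (λ b → move _ _ b fromSouth) elbow-C))
      (cong (visit C) (walk-via P _ (cong (λ b → move _ _ b fromWest) cross-D)))))))
      (on-strand-A fromSouth (pd⇒above-antidiagonal P pd (suc i) j cross-A))

    cross-twice : ∀ {m m'} (X : Through m) (Y : Through m') → 2 ≤ crossings P (Through.start X) (Through.start Y)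
    cross-twice {m} X Y = subst (λ xs → 2 ≤ countᵇ crossed-by-Y xs) (sym (Through.path X))
      (countᵇ-≥2 crossed-by-Y (Through.before X) A m D (Through.rest X)
        (cong₂ _∧_ cross-A (on-Y (here refl))) (cong₂ _∧_ cross-D (on-Y (there (there (here refl))))))
      where
      crossed-by-Y : Cell → Bool
      crossed-by-Y rc = crossAt P (proj₁ rc) (proj₂ rc) ∧ elemCell rc (strandPath P (Through.start Y))
      on-Y : ∀ {x} → x ∈ A ∷ _ ∷ D ∷ Through.rest Y → elemCell x (strandPath P (Through.start Y)) ≡ true
      on-Y x∈ = trans (cong (elemCell _) (Through.path Y)) (elemCell-∈ (∈-++⁺ʳ (Through.before Y) x∈))

    -- If both strands were the same, by `steps` it would reach A after the same prefix and then visit both E and C.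
    two-strands-through-block : Through E → Through C → ⊥
    two-strands-through-block W S with <-cmp (Through.start W) (Through.start S)
    ... | tri< lt _ _ = <⇒≱ (reduced⇒crossings<2 P red lt (Through.start<n S)) (cross-twice W S)
    ... | tri> _ _ gt = <⇒≱ (reduced⇒crossings<2 P red gt (Through.start<n W)) (cross-twice S W)
    ... | tri≈ _ same _ = 1+n≢n (,-injectiveˡ (∷-injectiveˡ (∷-injectiveʳ
          (++-cancel-length (Through.before W) (Through.before S) same-length
            (trans (sym (Through.path W)) (trans (cong (strandPath P) same) (Through.path S)))))))
      where
      same-length = +-cancelʳ-≡ (suc i) _ _ (trans (Through.steps W) (trans (cong (_+ j) same) (sym (Through.steps S))))

  reduced-no-double-cross : ⊥
  reduced-no-double-cross = two-strands-through-block strand-from-west strand-from-south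

-- Slide moves

firstTrue-just : ∀ {m} (v : Vec Bool m) {k} → firstTrue v ≡ just k →
                 vat false v k ≡ true × (∀ c → c < k → vat false v c ≡ false)
firstTrue-just (true V.∷ v) refl = refl , λ c ()
firstTrue-just (false V.∷ v) eq with firstTrue v in eq'
firstTrue-just (false V.∷ v) refl | just k with firstTrue-just v eq'
... | first , none-before = first , λ { zero _ → refl ; (suc c) (s≤s c<k) → none-before c c<k }

firstTrue-nothing : ∀ {m} (v : Vec Bool m) → firstTrue v ≡ nothing → ∀ c → vat false v c ≡ false
firstTrue-nothing V.[] _ c = refl
firstTrue-nothing (false V.∷ v) eq c with firstTrue v in eq'
firstTrue-nothing (false V.∷ v) eq zero | nothing = refl
firstTrue-nothing (false V.∷ v) eq (suc c) | nothing = firstTrue-nothing v eq' c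

lastTrue-nothing : ∀ {m} (v : Vec Bool m) → lastTrue v ≡ nothing → ∀ c → vat false v c ≡ false
lastTrue-nothing V.[] _ c = refl
lastTrue-nothing (x V.∷ v) eq c with lastTrue v in eq'
lastTrue-nothing (false V.∷ v) eq zero | nothing = refl
lastTrue-nothing (false V.∷ v) eq (suc c) | nothing = lastTrue-nothing v eq' c

lastTrue-just : ∀ {m} (v : Vec Bool m) {k} → lastTrue v ≡ just k →
                vat false v k ≡ true × (∀ c → k < c → vat false v c ≡ false)
lastTrue-just (x V.∷ v) eq with lastTrue v in eq'
lastTrue-just (x V.∷ v) refl | just k with lastTrue-just v eq'
... | last , none-after = last , λ { (suc c) (s≤s k<c) → none-after c k<c }
lastTrue-just (true V.∷ v) refl | nothing = refl , λ { (suc c) _ → lastTrue-nothing v eq' c }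

module _ {n : ℕ} (P : Grid n) (i : ℕ) where

  slideCol-empty : firstTrue (rowAt P i) ≡ nothing → slideCol P i ≡ nothing
  slideCol-empty first rewrite first = refl

  slideCol-column-0 : firstTrue (rowAt P i) ≡ just 0 → slideCol P i ≡ nothing
  slideCol-column-0 first rewrite first = refl

  slideCol-free : ∀ {j} → firstTrue (rowAt P i) ≡ just (suc j) → lastTrue (rowAt P (suc i)) ≡ nothing →
                  slideCol P i ≡ just (suc j)
  slideCol-free first last rewrite first | last = refl

  slideCol-clear : ∀ {j k} → firstTrue (rowAt P i) ≡ just (suc j) → lastTrue (rowAt P (suc i)) ≡ just k →
                   (k <ᵇ suc j) ≡ true → slideCol P i ≡ just (suc j)
  slideCol-clear first last k<j rewrite first | last | k<j = refl

  slideCol-blocked : ∀ {j k} → firstTrue (rowAt P i) ≡ just (suc j) → lastTrue (rowAt P (suc i)) ≡ just k →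
                     (k <ᵇ suc j) ≡ false → slideCol P i ≡ nothing
  slideCol-blocked first last k≮j rewrite first | last | k≮j = refl

  slide-at : ∀ {j} → slideCol P i ≡ just j → slide P i ≡ setCell (setCell P i j false) (suc i) (j ∸ 1) true
  slide-at col rewrite col = refl

  slide-stuck : slideCol P i ≡ nothing → slide P i ≡ P
  slide-stuck col rewrite col = refl

  record Slidable : Set where
    field
      j : ℕ
      col : slideCol P i ≡ just (suc j)
      leftmost : crossAt P i (suc j) ≡ true
      left-empty : ∀ c → c ≤ j → crossAt P i c ≡ false
      below-right-empty : ∀ c → suc j ≤ c → crossAt P (suc i) c ≡ false

  data SlideCase : Set where
    slidable : Slidable → SlideCase
    empty-row : slideCol P i ≡ nothing → (∀ c → crossAt P i c ≡ false) → SlideCase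
    cross-in-column-0 : slideCol P i ≡ nothing → crossAt P i 0 ≡ true → SlideCase
    blocked : slideCol P i ≡ nothing → ∀ j k →
              crossAt P i (suc j) ≡ true → (∀ c → c ≤ j → crossAt P i c ≡ false) →
              crossAt P (suc i) k ≡ true → (∀ c → k < c → crossAt P (suc i) c ≡ false) → suc j ≤ k → SlideCase

  private
    first-cross : ∀ {k} → firstTrue (rowAt P i) ≡ just k → crossAt P i k ≡ true × (∀ c → c < k → crossAt P i c ≡ false)
    first-cross first with firstTrue-just (rowAt P i) first
    ... | cross , none-before = trans (crossAt-rowAt P i _) cross , λ c c<k → trans (crossAt-rowAt P i c) (none-before c c<k)

    last-cross : ∀ {k} → lastTrue (rowAt P (suc i)) ≡ just k →
                 crossAt P (suc i) k ≡ true × (∀ c → k < c → crossAt P (suc i) c ≡ false)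
    last-cross last with lastTrue-just (rowAt P (suc i)) last
    ... | cross , none-after = trans (crossAt-rowAt P (suc i) _) cross , λ c k<c → trans (crossAt-rowAt P (suc i) c) (none-after c k<c)

    slidable-when : ∀ {j} → firstTrue (rowAt P i) ≡ just (suc j) → slideCol P i ≡ just (suc j) →
                    (∀ c → suc j ≤ c → crossAt P (suc i) c ≡ false) → Slidable
    slidable-when {j} first col right-empty = record
      { j = j ; col = col ; leftmost = proj₁ (first-cross first)
      ; left-empty = λ c c≤j → proj₂ (first-cross first) c (s≤s c≤j) ; below-right-empty = right-empty }

  slide-case : SlideCase
  slide-case with firstTrue (rowAt P i) in first
  ... | nothing = empty-row (slideCol-empty first) (λ c → trans (crossAt-rowAt P i c) (firstTrue-nothing (rowAt P i) first c))
  ... | just zero = cross-in-column-0 (slideCol-column-0 first) (proj₁ (first-cross first))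
  ... | just (suc j) with lastTrue (rowAt P (suc i)) in last
  ...   | nothing = slidable (slidable-when first (slideCol-free first last)
                      (λ c _ → trans (crossAt-rowAt P (suc i) c) (lastTrue-nothing (rowAt P (suc i)) last c)))
  ...   | just k with k <ᵇ suc j in k<j
  ...     | true = slidable (slidable-when first (slideCol-clear first last k<j)
                     (λ c j<c → proj₂ (last-cross last) c (≤-trans (<ᵇ⇒< k (suc j) (Equivalence.from T-≡ k<j)) j<c)))
  ...     | false = blocked (slideCol-blocked first last k<j) j k (proj₁ (first-cross first))
                      (λ c c≤j → proj₂ (first-cross first) c (s≤s c≤j)) (proj₁ (last-cross last)) (proj₂ (last-cross last))
                      (≮⇒≥ (λ k<j' → false≢true (trans (sym k<j) (Equivalence.to T-≡ (<⇒<ᵇ k<j')))))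

∧-cong-⇒ : ∀ a {b b'} → (a ≡ true → b ≡ b') → a ∧ b ≡ a ∧ b'
∧-cong-⇒ true same = same refl
∧-cong-⇒ false same = refl

vecEq-sound : ∀ {A : Set} {m} (e : A → A → Bool) → (∀ a b → e a b ≡ true → a ≡ b) →
              (xs ys : Vec A m) → vecEq e xs ys ≡ true → xs ≡ ys
vecEq-sound e sound V.[] V.[] _ = refl
vecEq-sound e sound (x V.∷ xs) (y V.∷ ys) eq with ∧≡true⁻ {e x y} eq
... | head , tail = cong₂ V._∷_ (sound x y head) (vecEq-sound e sound xs ys tail)

vecEq-refl : ∀ {A : Set} {m} (e : A → A → Bool) → (∀ a → e a a ≡ true) → (xs : Vec A m) → vecEq e xs xs ≡ true
vecEq-refl e refl-e V.[] = refl
vecEq-refl e refl-e (x V.∷ xs) rewrite refl-e x = vecEq-refl e refl-e xs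

boolEq-sound : ∀ a b → boolEq a b ≡ true → a ≡ b
boolEq-sound true true _ = refl
boolEq-sound false false _ = refl

boolEq-refl : ∀ a → boolEq a a ≡ true
boolEq-refl true = refl
boolEq-refl false = refl

gridEq-sound : ∀ {n} (G H : Grid n) → gridEq G H ≡ true → G ≡ H
gridEq-sound = vecEq-sound _ (vecEq-sound boolEq boolEq-sound)

gridEq-refl : ∀ {n} (G : Grid n) → gridEq G G ≡ true
gridEq-refl = vecEq-refl _ (vecEq-refl boolEq boolEq-refl)

elemCell-countᵇ : ∀ x xs → elemCell x xs ≡ (0 <ᵇ countᵇ (cellEq x) xs)
elemCell-countᵇ x [] = refl
elemCell-countᵇ x (y ∷ ys) with cellEq x y
... | true = refl
... | false = elemCell-countᵇ x ys

module Slide {n : ℕ} {P : Grid n} {i} (pd : isPipeDream P ≡ true) (S : Slidable P i) where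

  open Slidable S
  open Block i j

  slid : Grid n
  slid = setCell (setCell P i (suc j) false) (suc i) j true

  slide≡slid : slide P i ≡ slid
  slide≡slid = slide-at P i col

  room : i + j + 3 ≤ n
  room = block-fits P pd leftmost

  suc-j<n : suc j < n
  suc-j<n = proj₂ (crossAt-bounded P leftmost)

  suc-i<n : suc i < n
  suc-i<n = ≤-trans (s≤s (s≤s (≤-trans (m≤m+n i j) (n≤1+n _)))) (≤-trans (≤-reflexive (+-comm 3 (i + j))) room)

  slid-A : crossAt slid (suc i) j ≡ true
  slid-A = crossAt-setCell-≡ (setCell P i (suc j) false) true suc-i<n (<⇒≤ suc-j<n)

  slid-D : crossAt slid i (suc j) ≡ false
  slid-D = trans (crossAt-setCell-≢ (setCell P i (suc j) false) true A≢D)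
                 (crossAt-setCell-≡ P false (proj₁ (crossAt-bounded P leftmost)) suc-j<n)

  slid-agree : ∀ {r c} → (r , c) ≢ A → (r , c) ≢ D → crossAt P r c ≡ crossAt slid r c
  slid-agree ≢A ≢D = sym (trans (crossAt-setCell-≢ (setCell P i (suc j) false) true (≢-sym ≢A)) (crossAt-setCell-≢ P false (≢-sym ≢D)))

  slid-pd : isPipeDream slid ≡ true
  slid-pd = above-antidiagonal⇒pd slid above
    where
    above : ∀ {r c} → crossAt slid r c ≡ true → suc (r + c) < n
    above {r} {c} cross with (r , c) ≟ᶜ A | (r , c) ≟ᶜ D
    ... | yes refl | _ = ≤-trans (≤-reflexive (cong (λ k → suc (suc k)) (sym (+-suc i j))))
                                 (pd⇒above-antidiagonal P pd i (suc j) leftmost)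
    ... | no _ | yes refl = ⊥-elim (false≢true (trans (sym slid-D) cross))
    ... | no ≢A | no ≢D = pd⇒above-antidiagonal P pd r c (trans (slid-agree ≢A ≢D) cross)

  module _ (elbow-A : crossAt P (suc i) j ≡ false) where

    private
      elbow-C : crossAt P i j ≡ false
      elbow-C = left-empty j ≤-refl

      elbow-E : crossAt P (suc i) (suc j) ≡ false
      elbow-E = below-right-empty (suc j) ≤-refl

      before-slide : Antidiagonal P false
      before-slide = record { at-A = elbow-A ; at-D = leftmost ; at-C = elbow-C ; at-E = elbow-E }

      after-slide : Antidiagonal slid true
      after-slide = record
        { at-A = slid-A ; at-D = slid-D
        ; at-C = trans (sym (slid-agree C≢A C≢D)) elbow-C
        ; at-E = trans (sym (slid-agree E≢A E≢D)) elbow-E }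

      module Across = Simulation P slid room before-slide after-slide slid-agree

    exit-preserved : ∀ a → a < n → exitCol P a ≡ exitCol slid a
    exit-preserved a a<n = proj₂ (Across.strand-related (λ _ → false) (λ _ → false) (λ _ _ → refl) refl refl a a<n)

    elemCell-preserved : ∀ {y} → y ≢ C → y ≢ E → ∀ a → a < n →
                         elemCell y (strandPath P a) ≡ elemCell y (strandPath slid a)
    elemCell-preserved {y} ≢C ≢E a a<n = begin
      elemCell y (strandPath P a)                  ≡⟨ elemCell-countᵇ y (strandPath P a) ⟩
      0 <ᵇ countᵇ (cellEq y) (strandPath P a)      ≡⟨ cong (0 <ᵇ_) (proj₁ (Across.strand-related (cellEq y) (cellEq y)
                                                        (λ _ _ → refl) across (sym across) a a<n)) ⟩
      0 <ᵇ countᵇ (cellEq y) (strandPath slid a)   ≡⟨ sym (elemCell-countᵇ y (strandPath slid a)) ⟩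
      elemCell y (strandPath slid a)               ∎
      where
      open ≡-Reasoning
      across : countᵇ (cellEq y) (A ∷ C ∷ D ∷ []) ≡ countᵇ (cellEq y) (A ∷ E ∷ D ∷ [])
      across = trans (countᵇ-block (cellEq y) C refl (cellEq-≢ y C ≢C) refl)
                     (sym (countᵇ-block (cellEq y) E refl (cellEq-≢ y E ≢E) refl))

    A-on-strand⇔D-on-strand : ∀ a → a < n → elemCell A (strandPath P a) ≡ elemCell D (strandPath P a)
    A-on-strand⇔D-on-strand a a<n = begin
      elemCell A (strandPath P a)                ≡⟨ elemCell-countᵇ A (strandPath P a) ⟩
      0 <ᵇ countᵇ (cellEq A) (strandPath P a)    ≡⟨ cong (0 <ᵇ_) (proj₁ (Along.strand-related a a<n)) ⟩
      0 <ᵇ countᵇ (cellEq D) (strandPath P a)    ≡⟨ sym (elemCell-countᵇ D (strandPath P a)) ⟩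
      elemCell D (strandPath P a)                ∎
      where
      open ≡-Reasoning
      once : ∀ m → m ≢ A → m ≢ D → countᵇ (cellEq A) (A ∷ m ∷ D ∷ []) ≡ countᵇ (cellEq D) (A ∷ m ∷ D ∷ [])
      once m ≢A ≢D = trans (countᵇ-block (cellEq A) m (cellEq-refl A) (cellEq-≢ A m (≢-sym ≢A)) (cellEq-≢ A D A≢D))
                           (sym (countᵇ-block (cellEq D) m (cellEq-≢ D A (≢-sym A≢D)) (cellEq-≢ D m (≢-sym ≢D)) (cellEq-refl D)))
      module Along = Simulation P P room before-slide before-slide (λ _ _ → refl) (cellEq A) (cellEq D)
        (λ ≢A ≢D → trans (cellEq-≢ A _ (≢-sym ≢A)) (sym (cellEq-≢ D _ (≢-sym ≢D))))
        (once C C≢A C≢D) (once E E≢A E≢D)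

    crossings-preserved : ∀ a b → a < n → b < n → crossings P a b ≡ crossings slid a b
    crossings-preserved a b a<n b<n = proj₁ (Across.strand-related crossed crossed' agree-outside
      (swap C E (elbow⇒uncrossed elbow-C) (elbow⇒uncrossed' (Antidiagonal.at-E after-slide)))
      (swap E C (elbow⇒uncrossed elbow-E) (elbow⇒uncrossed' (Antidiagonal.at-C after-slide))) a a<n)
      where
      crossed crossed' : Cell → Bool
      crossed y = crossAt P (proj₁ y) (proj₂ y) ∧ elemCell y (strandPath P b)
      crossed' y = crossAt slid (proj₁ y) (proj₂ y) ∧ elemCell y (strandPath slid b)

      elbow⇒uncrossed : ∀ {r c} → crossAt P r c ≡ false → crossed (r , c) ≡ false
      elbow⇒uncrossed {r} {c} elbow = cong (_∧ elemCell (r , c) (strandPath P b)) elbow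

      elbow⇒uncrossed' : ∀ {r c} → crossAt slid r c ≡ false → crossed' (r , c) ≡ false
      elbow⇒uncrossed' {r} {c} elbow = cong (_∧ elemCell (r , c) (strandPath slid b)) elbow

      agree-outside : ∀ {y} → y ≢ A → y ≢ D → crossed y ≡ crossed' y
      agree-outside {r , c} ≢A ≢D = trans (cong (_∧ elemCell (r , c) (strandPath P b)) same)
        (∧-cong-⇒ (crossAt slid r c) λ cross → elemCell-preserved (cross≢elbow P (trans same cross) elbow-C)
                                                                    (cross≢elbow P (trans same cross) elbow-E) b b<n)
        where same = slid-agree ≢A ≢D

      D-on-b = elemCell D (strandPath P b)

      A-crossed' : crossed' A ≡ D-on-b
      A-crossed' = begin
        crossed' A                                ≡⟨ cong (_∧ elemCell A (strandPath slid b)) slid-A ⟩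
        elemCell A (strandPath slid b)            ≡⟨ sym (elemCell-preserved (≢-sym C≢A) (≢-sym E≢A) b b<n) ⟩
        elemCell A (strandPath P b)               ≡⟨ A-on-strand⇔D-on-strand b b<n ⟩
        D-on-b                                    ∎
        where open ≡-Reasoning

      swap : ∀ m m' → crossed m ≡ false → crossed' m' ≡ false →
             countᵇ crossed (A ∷ m ∷ D ∷ []) ≡ countᵇ crossed' (A ∷ m' ∷ D ∷ [])
      swap m m' m-elbow m'-elbow = trans (countᵇ-block crossed m (elbow⇒uncrossed elbow-A) m-elbow
                                                    (cong (_∧ D-on-b) leftmost))
        (trans (sym (+-identityʳ (bit D-on-b)))
               (sym (countᵇ-block crossed' m' A-crossed' m'-elbow (elbow⇒uncrossed' slid-D))))

    reduced-preserved : isReduced P ≡ isReduced slid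
    reduced-preserved = all-cong _ _ (upTo n) λ a a∈ → all-cong _ _ (upTo n) λ b b∈ →
      cong (λ k → not (a <ᵇ b) ∨ (k <ᵇ 2)) (crossings-preserved a b (∈-upTo⁻ a∈) (∈-upTo⁻ b∈))

    shape-preserved : ∀ (w : Permutation′ n) → hasShape w P ≡ hasShape w slid
    shape-preserved w = all-cong _ _ (allFin n) λ a _ →
      cong (_≡ᵇ toℕ (w ⟨$⟩ʳ a)) (exit-preserved (toℕ a) (toℕ<n a))

-- Quasi-Yamanouchi row decompositions of a word

Decreasing : List ℕ → Set
Decreasing = AllPairs _>_

firstRow : List (List ℕ) → List ℕ
firstRow [] = []
firstRow (R ∷ _) = R

-- The quasi-Yamanouchi condition between rows r and r + 1, read off their words: row r is empty,
-- or its leftmost cross is in column 0 (last letter r + 1), or that cross is not right of the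
-- rightmost cross of row r + 1.
data Boundary (r : ℕ) (R R' : List ℕ) : Set where
  empty-row : R ≡ [] → Boundary r R R'
  ends-at-diagonal : ∀ X → R ≡ X ∷ʳ suc r → Boundary r R R'
  ascent : ∀ X ℓ y Y → R ≡ X ∷ʳ ℓ → R' ≡ y ∷ Y → ℓ < y → Boundary r R R'

data QuasiYamanouchi (r : ℕ) : List (List ℕ) → Set where
  [] : QuasiYamanouchi r []
  row : ∀ {R Rs} → Decreasing R → All (r <_) R → Boundary r R (firstRow Rs) → QuasiYamanouchi (suc r) Rs →
        QuasiYamanouchi r (R ∷ Rs)

Ascent : List ℕ → List ℕ → Set
Ascent R U = ∀ X ℓ y U' → R ≡ X ∷ʳ ℓ → U ≡ y ∷ U' → ℓ < y

[]≢∷ʳ : ∀ {A : Set} (X : List A) x → [] ≢ X ∷ʳ x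
[]≢∷ʳ [] x ()
[]≢∷ʳ (_ ∷ _) x ()

qy-above : ∀ {r Rs} → QuasiYamanouchi r Rs → All (r <_) (concat Rs)
qy-above [] = []
qy-above (row _ above _ rest) = All.++⁺ above (All.map (<-trans (n<1+n _)) (qy-above rest))

qy-ascent : ∀ {r R Rs} → QuasiYamanouchi r (R ∷ Rs) → Ascent R (concat Rs)
qy-ascent (row _ _ (empty-row refl) _) X ℓ y U' R≡ _ = ⊥-elim ([]≢∷ʳ X ℓ R≡)
qy-ascent {Rs = Rs} (row _ _ (ends-at-diagonal X₀ refl) rest) X ℓ y U' R≡ U≡
  with ∷ʳ-injective X₀ X R≡
... | _ , refl = first-above (concat Rs) U≡ (qy-above rest)
  where
  first-above : ∀ U → U ≡ y ∷ U' → All (suc _ <_) U → _ < y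
  first-above (u ∷ _) refl (above ∷ _) = above
qy-ascent {Rs = _ ∷ _} (row _ _ (ascent X₀ ℓ₀ y₀ Y₀ refl refl ℓ₀<y₀) _) X ℓ y U' R≡ U≡
  with ∷ʳ-injective X₀ X R≡ | ∷-injective U≡
... | _ , refl | refl , _ = ℓ₀<y₀

decreasing-prefix-unique : ∀ R F {U V} → Decreasing R → Decreasing F → R ≢ [] → F ≢ [] →
                           Ascent R U → Ascent F V → R ++ U ≡ F ++ V → R ≡ F × U ≡ V
decreasing-prefix-unique [] F _ _ R≢[] _ _ _ _ = ⊥-elim (R≢[] refl)
decreasing-prefix-unique (x ∷ R) [] _ _ _ F≢[] _ _ _ = ⊥-elim (F≢[] refl)
decreasing-prefix-unique (x ∷ []) (x' ∷ []) _ _ _ _ _ _ eq with ∷-injective eq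
... | refl , U≡V = refl , U≡V
decreasing-prefix-unique (x ∷ []) (x' ∷ f ∷ F) {V = V} _ ((x>f ∷ _) ∷ _) _ _ ascR _ eq with ∷-injective eq
... | refl , U≡ = ⊥-elim (<-asym x>f (ascR [] x f (F ++ V) refl U≡))
decreasing-prefix-unique (x ∷ r ∷ R) (x' ∷ []) {U} ((x>r ∷ _) ∷ _) _ _ _ _ ascF eq with ∷-injective eq
... | refl , V≡ = ⊥-elim (<-asym x>r (ascF [] x r (R ++ U) refl (sym V≡)))
decreasing-prefix-unique (x ∷ r ∷ R) (x' ∷ f ∷ F) (_ ∷ decR) (_ ∷ decF) _ _ ascR ascF eq
  with ∷-injective eq
... | refl , eq' with decreasing-prefix-unique (r ∷ R) (f ∷ F) decR decF (λ ()) (λ ())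
                        (λ X ℓ y U' R≡ → ascR (x ∷ X) ℓ y U' (cong (x ∷_) R≡))
                        (λ X ℓ y V' F≡ → ascF (x ∷ X) ℓ y V' (cong (x ∷_) F≡)) eq'
...   | R≡F , U≡V = cong (x ∷_) R≡F , U≡V

qy-level-mismatch : ∀ {r s} F Ys Xs → r < s → QuasiYamanouchi s Xs → F ≢ [] → Decreasing F →
                    Boundary r F (firstRow Ys) → QuasiYamanouchi (suc r) Ys → concat Xs ≡ F ++ concat Ys → ⊥
qy-level-mismatch [] _ _ _ _ F≢[] _ _ _ _ = F≢[] refl
qy-level-mismatch (f ∷ F) Ys [] _ _ _ _ _ _ ()
qy-level-mismatch F Ys ([] ∷ Xs) r<s (row _ _ _ qyX) F≢[] decF bd qyY eq =
  qy-level-mismatch F Ys Xs (<-trans r<s (n<1+n _)) qyX F≢[] decF bd qyY eq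
qy-level-mismatch F Ys ((x ∷ R) ∷ Xs) r<s qyX F≢[] decF (empty-row F≡[]) qyY eq = F≢[] F≡[]
qy-level-mismatch {r} {s} F Ys ((x ∷ R) ∷ Xs) r<s qyX F≢[] decF (ends-at-diagonal X F≡) qyY eq =
  <-irrefl refl (<-≤-trans r<s (≤-pred last-above))
  where
  last-above : s < suc r
  last-above with All.++⁻ʳ X (subst (All (s <_)) F≡ (All.++⁻ˡ F (subst (All (s <_)) eq (qy-above qyX))))
  ... | above ∷ [] = above
qy-level-mismatch F [] ((x ∷ R) ∷ Xs) _ _ _ _ (ascent _ _ _ _ _ () _) _ _
qy-level-mismatch F ([] ∷ Ys) ((x ∷ R) ∷ Xs) _ _ _ _ (ascent _ _ _ _ _ () _) _ _
qy-level-mismatch F ((y ∷ Y) ∷ Ys) ((x ∷ R) ∷ Xs) r<s qyX@(row decR _ _ qyX') F≢[] decF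
                  (ascent X ℓ _ _ F≡ refl ℓ<y) (row decY _ bdY qyY') eq =
  qy-level-mismatch (y ∷ Y) Ys Xs (s≤s r<s) qyX' (λ ()) decY bdY qyY'
    (proj₂ (decreasing-prefix-unique (x ∷ R) F decR decF (λ ()) F≢[] (qy-ascent qyX) ascentF eq))
  where
  ascentF : Ascent F (concat ((y ∷ Y) ∷ Ys))
  ascentF X' ℓ' y' U' F≡' U≡ with ∷ʳ-injective X X' (trans (sym F≡) F≡') | ∷-injective U≡
  ... | _ , refl | refl , _ = ℓ<y

qy-unique : ∀ {r} Xs Ys → QuasiYamanouchi r Xs → QuasiYamanouchi r Ys → length Xs ≡ length Ys →
            concat Xs ≡ concat Ys → Xs ≡ Ys
qy-unique [] [] _ _ _ _ = refl
qy-unique ([] ∷ Xs) ([] ∷ Ys) (row _ _ _ qyX) (row _ _ _ qyY) lengths eq =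
  cong ([] ∷_) (qy-unique Xs Ys qyX qyY (suc-injective lengths) eq)
qy-unique ([] ∷ Xs) ((y ∷ R) ∷ Ys) (row _ _ _ qyX) (row decR _ bd qyY) _ eq =
  ⊥-elim (qy-level-mismatch (y ∷ R) Ys Xs ≤-refl qyX (λ ()) decR bd qyY eq)
qy-unique ((x ∷ R) ∷ Xs) ([] ∷ Ys) (row decR _ bd qyX) (row _ _ _ qyY) _ eq =
  ⊥-elim (qy-level-mismatch (x ∷ R) Xs Ys ≤-refl qyY (λ ()) decR bd qyX (sym eq))
qy-unique ((x ∷ R) ∷ Xs) ((y ∷ R') ∷ Ys) qyX@(row decR _ _ qyX') qyY@(row decR' _ _ qyY') lengths eq
  with decreasing-prefix-unique (x ∷ R) (y ∷ R') decR decR' (λ ()) (λ ()) (qy-ascent qyX) (qy-ascent qyY) eq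
... | R≡R' , rest≡ = cong₂ _∷_ R≡R' (qy-unique Xs Ys qyX' qyY' (suc-injective lengths) rest≡)

data PairIn++ (R T : List ℕ) (a b : ℕ) : Set where
  in-left : ∀ U V → R ≡ U ++ a ∷ b ∷ V → PairIn++ R T a b
  across : ∀ X T' → R ≡ X ∷ʳ a → T ≡ b ∷ T' → PairIn++ R T a b
  in-right : ∀ U V → T ≡ U ++ a ∷ b ∷ V → PairIn++ R T a b

pairIn++ : ∀ R T U {a b V} → R ++ T ≡ U ++ a ∷ b ∷ V → PairIn++ R T a b
pairIn++ [] T U eq = in-right U _ eq
pairIn++ (x ∷ []) T [] eq with ∷-injective eq
... | refl , T≡ = across [] _ refl T≡
pairIn++ (x ∷ y ∷ R) T [] eq with ∷-injective eq
... | refl , eq' with ∷-injective eq'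
...   | refl , _ = in-left [] R refl
pairIn++ (x ∷ R) T (u ∷ U) eq with ∷-injective eq
... | refl , eq' with pairIn++ R T U eq'
...   | in-left U' V R≡ = in-left (x ∷ U') V (cong (x ∷_) R≡)
...   | across X T' R≡ T≡ = across (x ∷ X) T' (cong (x ∷_) R≡) T≡
...   | in-right U' V T≡ = in-right U' V T≡

decreasing-no-repeat : ∀ U {a V} → Decreasing (U ++ a ∷ a ∷ V) → ⊥
decreasing-no-repeat [] ((a>a ∷ _) ∷ _) = <-irrefl refl a>a
decreasing-no-repeat (u ∷ U) (_ ∷ dec) = decreasing-no-repeat U dec

qy-no-repeat : ∀ {r Rs} → QuasiYamanouchi r Rs → ∀ U ℓ V → concat Rs ≢ U ++ ℓ ∷ ℓ ∷ V
qy-no-repeat [] [] ℓ V ()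
qy-no-repeat [] (_ ∷ _) ℓ V ()
qy-no-repeat {Rs = R ∷ Rs} qy@(row decR _ _ qy') U ℓ V eq with pairIn++ R (concat Rs) U eq
... | in-left U' V' R≡ = decreasing-no-repeat U' (subst Decreasing R≡ decR)
... | across X T' R≡ T≡ = <-irrefl refl (qy-ascent qy X ℓ ℓ T' R≡ T≡)
... | in-right U' V' T≡ = qy-no-repeat qy' U' ℓ V' T≡

adjacent-rows-repeat : ∀ k (h : ℕ → List ℕ) i X ℓ Y → suc i < k → h i ≡ X ∷ʳ ℓ → h (suc i) ≡ ℓ ∷ Y →
                       ∃[ U ] ∃[ V ] concat (applyUpTo h k) ≡ U ++ ℓ ∷ ℓ ∷ V
adjacent-rows-repeat (suc (suc k)) h zero X ℓ Y _ h₀ h₁ =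
  X , Y ++ later , trans (cong₂ _++_ h₀ (cong (_++ later) h₁)) (++-assoc X (ℓ ∷ []) _)
  where later = concat (applyUpTo (λ x → h (suc (suc x))) k)
adjacent-rows-repeat (suc k) h (suc i) X ℓ Y (s≤s i<k) hᵢ hᵢ₊₁
  with adjacent-rows-repeat k (λ x → h (suc x)) i X ℓ Y i<k hᵢ hᵢ₊₁
... | U , V , eq = h 0 ++ U , V , trans (cong (h 0 ++_) eq) (sym (++-assoc (h 0) U _))

-- Each letter contributes the index of its row.
weight : List (List ℕ) → ℕ
weight [] = 0
weight (R ∷ Rs) = length (concat Rs) + weight Rs

applyUpTo-cong : ∀ {A : Set} (f g : ℕ → A) k → (∀ x → f x ≡ g x) → applyUpTo f k ≡ applyUpTo g k
applyUpTo-cong f g zero same = refl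
applyUpTo-cong f g (suc k) same = cong₂ _∷_ (same 0) (applyUpTo-cong (f ∘′ suc) (g ∘′ suc) k (λ x → same (suc x)))

move-letter-down : ∀ k (h h' : ℕ → List ℕ) i ℓ → suc i < k → h i ≡ h' i ∷ʳ ℓ → h' (suc i) ≡ ℓ ∷ h (suc i) →
                   (∀ r → r ≢ i → r ≢ suc i → h' r ≡ h r) →
                   concat (applyUpTo h' k) ≡ concat (applyUpTo h k) × weight (applyUpTo h' k) ≡ suc (weight (applyUpTo h k))
move-letter-down (suc (suc k)) h h' zero ℓ _ h₀ h₁ others = same-word , heavier
  where
  later' = applyUpTo (λ x → h' (suc (suc x))) k
  later = applyUpTo (λ x → h (suc (suc x))) k
  same-later : later' ≡ later
  same-later = applyUpTo-cong _ _ k (λ x → others (suc (suc x)) (λ ()) (λ ()))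
  same-word : h' 0 ++ (h' 1 ++ concat later') ≡ h 0 ++ (h 1 ++ concat later)
  same-word rewrite same-later | h₀ | h₁ = sym (++-assoc (h' 0) (ℓ ∷ []) _)
  heavier : length (h' 1 ++ concat later') + (length (concat later') + weight later') ≡
            suc (length (h 1 ++ concat later) + (length (concat later) + weight later))
  heavier rewrite same-later | h₁ = refl
move-letter-down (suc k) h h' (suc i) ℓ (s≤s i<k) hᵢ hᵢ₊₁ others
  with move-letter-down k (h ∘′ suc) (h' ∘′ suc) i ℓ i<k hᵢ hᵢ₊₁ (λ r r≢i r≢i+1 → others (suc r) (r≢i ∘′ suc-injective) (r≢i+1 ∘′ suc-injective))
... | same-word , heavier rewrite others 0 (λ ()) (λ ()) =
  cong (h 0 ++_) same-word , trans (cong₂ _+_ (cong length same-word) heavier) (+-suc _ _)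

weight-bound : ∀ Rs → weight Rs ≤ (length Rs ∸ 1) * length (concat Rs)
weight-bound [] = z≤n
weight-bound (R ∷ []) = z≤n
weight-bound (R ∷ R' ∷ Rs) =
  ≤-trans (+-monoʳ-≤ (length (concat (R' ∷ Rs))) (weight-bound (R' ∷ Rs)))
          (*-monoʳ-≤ (suc (length Rs)) (≤-trans (m≤n+m _ (length R)) (≤-reflexive (sym (length-++ R)))))

length-concat-applyUpTo : ∀ k (h : ℕ → List ℕ) m → (∀ x → length (h x) ≤ m) → length (concat (applyUpTo h k)) ≤ k * m
length-concat-applyUpTo zero h m short = z≤n
length-concat-applyUpTo (suc k) h m short = ≤-trans (≤-reflexive (length-++ (h 0)))
  (+-mono-≤ (short 0) (length-concat-applyUpTo k (h ∘′ suc) m (λ x → short (suc x))))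


downFrom-below : ∀ m → All (_< m) (downFrom m)
downFrom-below m = All.applyDownFrom⁺₁ (λ c → c) m (λ c<m → c<m)

filterᵇ-downFrom-below : ∀ g m → All (_< m) (filterᵇ g (downFrom m))
filterᵇ-downFrom-below g m = All.filter⁺ (λ c → T? (g c)) (downFrom-below m)

filterᵇ-downFrom-cong : ∀ g g' m → (∀ c → c < m → g c ≡ g' c) → filterᵇ g (downFrom m) ≡ filterᵇ g' (downFrom m)
filterᵇ-downFrom-cong g g' zero same = refl
filterᵇ-downFrom-cong g g' (suc m) same rewrite same m ≤-refl with g' m
... | true = cong (m ∷_) (filterᵇ-downFrom-cong g g' m (λ c c<m → same c (<-trans c<m (n<1+n m))))
... | false = filterᵇ-downFrom-cong g g' m (λ c c<m → same c (<-trans c<m (n<1+n m)))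

filterᵇ-downFrom-none : ∀ g m → (∀ c → c < m → g c ≡ false) → filterᵇ g (downFrom m) ≡ []
filterᵇ-downFrom-none g zero none = refl
filterᵇ-downFrom-none g (suc m) none rewrite none m ≤-refl = filterᵇ-downFrom-none g m (λ c c<m → none c (<-trans c<m (n<1+n m)))

filterᵇ-downFrom-last : ∀ g k m → k < m → g k ≡ true → (∀ c → c < k → g c ≡ false) →
                        ∃[ X ] filterᵇ g (downFrom m) ≡ X ∷ʳ k
filterᵇ-downFrom-last g k (suc m) (s≤s k≤m) gk none-below with m ≟ k
... | yes refl rewrite gk = [] , cong (k ∷_) (filterᵇ-downFrom-none g k none-below)
... | no m≢k with filterᵇ-downFrom-last g k m (≤∧≢⇒< k≤m (m≢k ∘′ sym)) gk none-below
...   | X , eq with g m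
...     | true = m ∷ X , cong (m ∷_) eq
...     | false = X , eq

filterᵇ-downFrom-head : ∀ g k m → k < m → g k ≡ true → (∀ c → k < c → g c ≡ false) →
                        ∃[ Y ] filterᵇ g (downFrom m) ≡ k ∷ Y
filterᵇ-downFrom-head g k (suc m) (s≤s k≤m) gk none-above with m ≟ k
... | yes refl rewrite gk = filterᵇ g (downFrom k) , refl
... | no m≢k rewrite none-above m (≤∧≢⇒< k≤m (m≢k ∘′ sym)) =
  filterᵇ-downFrom-head g k m (≤∧≢⇒< k≤m (m≢k ∘′ sym)) gk none-above

filterᵇ-downFrom-remove-last : ∀ g g' k m → k < m → g k ≡ true → g' k ≡ false → (∀ c → c ≢ k → g c ≡ g' c) →
                               (∀ c → c < k → g c ≡ false) → filterᵇ g (downFrom m) ≡ filterᵇ g' (downFrom m) ∷ʳ k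
filterᵇ-downFrom-remove-last g g' k (suc m) (s≤s k≤m) gk g'k others none-below with m ≟ k
... | yes refl rewrite gk | g'k | filterᵇ-downFrom-none g k none-below
                   | filterᵇ-downFrom-none g' k (λ c c<k → trans (sym (others c (<⇒≢ c<k))) (none-below c c<k)) = refl
... | no m≢k rewrite others m m≢k with g' m
...   | true = cong (m ∷_) (filterᵇ-downFrom-remove-last g g' k m (≤∧≢⇒< k≤m (m≢k ∘′ sym)) gk g'k others none-below)
...   | false = filterᵇ-downFrom-remove-last g g' k m (≤∧≢⇒< k≤m (m≢k ∘′ sym)) gk g'k others none-below

filterᵇ-downFrom-add-head : ∀ g g' k m → k < m → g' k ≡ true → g k ≡ false → (∀ c → c ≢ k → g c ≡ g' c) →
                            (∀ c → k < c → g c ≡ false) → filterᵇ g' (downFrom m) ≡ k ∷ filterᵇ g (downFrom m)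
filterᵇ-downFrom-add-head g g' k (suc m) (s≤s k≤m) g'k gk others none-above with m ≟ k
... | yes refl rewrite gk | g'k = cong (k ∷_) (filterᵇ-downFrom-cong g' g k (λ c c<k → sym (others c (<⇒≢ c<k))))
... | no m≢k rewrite sym (others m m≢k) | none-above m (≤∧≢⇒< k≤m (m≢k ∘′ sym)) =
  filterᵇ-downFrom-add-head g g' k m (≤∧≢⇒< k≤m (m≢k ∘′ sym)) g'k gk others none-above

filterᵇ-downFrom-suc-injective : ∀ g g' m → filterᵇ g (downFrom (suc m)) ≡ filterᵇ g' (downFrom (suc m)) →
                                 g m ≡ g' m × filterᵇ g (downFrom m) ≡ filterᵇ g' (downFrom m)
filterᵇ-downFrom-suc-injective g g' m eq with g m | g' m
... | true | true = refl , ∷-injectiveʳ eq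
... | false | false = refl , eq
... | true | false = ⊥-elim (head-not-below eq (filterᵇ-downFrom-below g' m))
  where
  head-not-below : ∀ {ys} → m ∷ filterᵇ g (downFrom m) ≡ ys → All (_< m) ys → ⊥
  head-not-below refl (m<m ∷ _) = <-irrefl refl m<m
... | false | true = ⊥-elim (head-not-below (sym eq) (filterᵇ-downFrom-below g m))
  where
  head-not-below : ∀ {ys} → m ∷ filterᵇ g' (downFrom m) ≡ ys → All (_< m) ys → ⊥
  head-not-below refl (m<m ∷ _) = <-irrefl refl m<m

filterᵇ-downFrom-injective : ∀ g g' m → filterᵇ g (downFrom m) ≡ filterᵇ g' (downFrom m) → ∀ c → c < m → g c ≡ g' c
filterᵇ-downFrom-injective g g' (suc m) eq c (s≤s c≤m) with filterᵇ-downFrom-suc-injective g g' m eq | m ≟ c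
... | same-head , _ | yes refl = same-head
... | _ , same-tail | no m≢c = filterᵇ-downFrom-injective g g' m same-tail c (≤∧≢⇒< c≤m (m≢c ∘′ sym))

rowWord : ∀ {n} → Grid n → ℕ → List ℕ
rowWord {n} P r = map (λ c → suc (r + c)) (filterᵇ (crossAt P r) (downFrom (n ∸ suc r)))

rowWords : ∀ {n} → Grid n → List (List ℕ)
rowWords {n} P = applyUpTo (rowWord P) n

private
  crossesOf : ∀ {n} → Grid n → List Cell → List Cell
  crossesOf P = filterᵇ (λ rc → crossAt P (proj₁ rc) (proj₂ rc))

  word-of-row : ∀ {n} (P : Grid n) r xs →
                map letter (crossesOf P (map (r ,_) xs)) ≡ map (λ c → suc (r + c)) (filterᵇ (crossAt P r) xs)
  word-of-row P r [] = refl
  word-of-row P r (x ∷ xs) with crossAt P r x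
  ... | true = cong (suc (r + x) ∷_) (word-of-row P r xs)
  ... | false = word-of-row P r xs

  word-of-rows : ∀ {n} (P : Grid n) rs →
                 map letter (crossesOf P (concatMap (λ r → map (r ,_) (downFrom (n ∸ suc r))) rs)) ≡ concat (map (rowWord P) rs)
  word-of-rows P [] = refl
  word-of-rows {n} P (r ∷ rs) = begin
    map letter (crossesOf P (cells r ++ concatMap cells rs))
      ≡⟨ cong (map letter) (filter-++ _ (cells r) (concatMap cells rs)) ⟩
    map letter (crossesOf P (cells r) ++ crossesOf P (concatMap cells rs))
      ≡⟨ map-++ letter (crossesOf P (cells r)) _ ⟩
    map letter (crossesOf P (cells r)) ++ map letter (crossesOf P (concatMap cells rs))
      ≡⟨ cong₂ _++_ (word-of-row P r (downFrom (n ∸ suc r))) (word-of-rows P rs) ⟩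
    rowWord P r ++ concat (map (rowWord P) rs) ∎
    where
    open ≡-Reasoning
    cells : ℕ → List Cell
    cells r = map (r ,_) (downFrom (n ∸ suc r))

word≡concat-rowWords : ∀ {n} (P : Grid n) → word P ≡ concat (rowWords P)
word≡concat-rowWords {n} P = trans (word-of-rows P (upTo n)) (cong concat (map-upTo (rowWord P) n))

QYRow : ℕ → List ℕ → List ℕ → Set
QYRow r R R' = Decreasing R × All (r <_) R × Boundary r R R'

qy-applyUpTo : ∀ k r (g : ℕ → List ℕ) → (∀ x → x < k → QYRow (r + x) (g x) (g (suc x))) → g k ≡ [] →
               QuasiYamanouchi r (applyUpTo g k)
qy-applyUpTo zero r g rows _ = []
qy-applyUpTo (suc k) r g rows last-empty with subst (λ l → QYRow l (g 0) (g 1)) (+-identityʳ r) (rows 0 (s≤s z≤n))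
... | dec , above , bd = row dec above (boundary k last-empty) (qy-applyUpTo k (suc r) (g ∘′ suc) shifted last-empty)
  where
  shifted : ∀ x → x < k → QYRow (suc r + x) (g (suc x)) (g (suc (suc x)))
  shifted x x<k = subst (λ l → QYRow l (g (suc x)) (g (suc (suc x)))) (+-suc r x) (rows (suc x) (s≤s x<k))
  boundary : ∀ k' → g (suc k') ≡ [] → Boundary r (g 0) (firstRow (applyUpTo (g ∘′ suc) k'))
  boundary zero g₁≡[] = subst (Boundary r (g 0)) g₁≡[] bd
  boundary (suc k') _ = bd

below-antidiagonal : ∀ {n r c} → suc (r + c) < n → c < n ∸ suc r
below-antidiagonal {n} {r} {c} above = m+n≤o⇒m≤o∸n (suc c) (≤-trans (≤-reflexive (cong suc (trans (+-suc c r) (cong suc (+-comm c r))))) above)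

module Rows {n : ℕ} (P : Grid n) (pd : isPipeDream P ≡ true) where

  rowWord-decreasing : ∀ r → Decreasing (rowWord P r)
  rowWord-decreasing r = AllPairs.map⁺ (AllPairs.map (λ c>c' → s≤s (+-monoʳ-< r c>c'))
    (AllPairs.filter⁺ (λ c → T? (crossAt P r c)) (AllPairs.applyDownFrom⁺₁ (λ c → c) (n ∸ suc r) (λ j<i _ → j<i))))

  rowWord-above : ∀ r → All (r <_) (rowWord P r)
  rowWord-above r = All.map⁺ (All.universal (λ c → s≤s (m≤m+n r c)) _)

  rowWord-empty : ∀ r → (∀ c → crossAt P r c ≡ false) → rowWord P r ≡ []
  rowWord-empty r none = cong (map _) (filterᵇ-downFrom-none (crossAt P r) (n ∸ suc r) (λ c _ → none c))

  rowWord-beyond : ∀ r → n ≤ suc r → rowWord P r ≡ []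
  rowWord-beyond r n≤r+1 rewrite m≤n⇒m∸n≡0 n≤r+1 = refl

  rowWord-last : ∀ r j → crossAt P r j ≡ true → (∀ c → c < j → crossAt P r c ≡ false) →
                 ∃[ X ] rowWord P r ≡ X ∷ʳ suc (r + j)
  rowWord-last r j cross none-before
    with filterᵇ-downFrom-last (crossAt P r) j (n ∸ suc r) (below-antidiagonal (pd⇒above-antidiagonal P pd r j cross)) cross none-before
  ... | X , eq = map (λ c → suc (r + c)) X , trans (cong (map _) eq) (map-++ _ X (j ∷ []))

  rowWord-head : ∀ r k → crossAt P r k ≡ true → (∀ c → k < c → crossAt P r c ≡ false) →
                 ∃[ Y ] rowWord P r ≡ suc (r + k) ∷ Y
  rowWord-head r k cross none-after
    with filterᵇ-downFrom-head (crossAt P r) k (n ∸ suc r) (below-antidiagonal (pd⇒above-antidiagonal P pd r k cross)) cross none-after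
  ... | Y , eq = map (λ c → suc (r + c)) Y , cong (map _) eq

  rowWord-boundary : ∀ i → slideCol P i ≡ nothing → Boundary i (rowWord P i) (rowWord P (suc i))
  rowWord-boundary i stuck with slide-case P i
  ... | slidable S = case trans (sym (Slidable.col S)) stuck of λ ()
  ... | empty-row _ none = empty-row (rowWord-empty i none)
  ... | cross-in-column-0 _ cross with rowWord-last i 0 cross (λ c ())
  ...   | X , eq = ends-at-diagonal X (trans eq (cong (λ k → X ∷ʳ suc k) (+-identityʳ i)))
  rowWord-boundary i stuck | blocked _ j k leftmost none-before rightmost none-after j<k
    with rowWord-last i (suc j) leftmost (λ c c<j → none-before c (≤-pred c<j)) | rowWord-head (suc i) k rightmost none-after
  ... | X , eqX | Y , eqY = ascent X _ _ Y eqX eqY (s≤s (s≤s (+-monoʳ-≤ i j<k)))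

  qy-rowWords : (∀ i → suc i < n → slideCol P i ≡ nothing) → QuasiYamanouchi 0 (rowWords P)
  qy-rowWords stuck = qy-applyUpTo n 0 (rowWord P) rows (rowWord-beyond n (n≤1+n n))
    where
    rows : ∀ x → x < n → QYRow x (rowWord P x) (rowWord P (suc x))
    rows x _ with suc x <? n
    ... | yes x+1<n = rowWord-decreasing x , rowWord-above x , rowWord-boundary x (stuck x x+1<n)
    ... | no x+1≮n = rowWord-decreasing x , rowWord-above x , empty-row (rowWord-beyond x (≮⇒≥ x+1≮n))

applyUpTo-injective : ∀ {A : Set} (f g : ℕ → A) k → applyUpTo f k ≡ applyUpTo g k → ∀ x → x < k → f x ≡ g x
applyUpTo-injective f g (suc k) eq zero _ = ∷-injectiveˡ eq
applyUpTo-injective f g (suc k) eq (suc x) (s≤s x<k) = applyUpTo-injective (f ∘′ suc) (g ∘′ suc) k (∷-injectiveʳ eq) x x<k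

rowWords-injective : ∀ {n} (P Q : Grid n) → isPipeDream P ≡ true → isPipeDream Q ≡ true → rowWords P ≡ rowWords Q → P ≡ Q
rowWords-injective {n} P Q pdP pdQ eq = grid-ext P Q same-cell
  where
  same-cell : ∀ r c → r < n → c < n → crossAt P r c ≡ crossAt Q r c
  same-cell r c r<n _ with c <? n ∸ suc r
  ... | yes c<m = filterᵇ-downFrom-injective (crossAt P r) (crossAt Q r) (n ∸ suc r)
        (map-injective (λ eq' → +-cancelˡ-≡ r _ _ (suc-injective eq')) (applyUpTo-injective (rowWord P) (rowWord Q) n eq r r<n)) c c<m
  ... | no c≮m with crossAt P r c in crossP | crossAt Q r c in crossQ
  ...   | true | _ = ⊥-elim (c≮m (below-antidiagonal (pd⇒above-antidiagonal P pdP r c crossP)))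
  ...   | false | true = ⊥-elim (c≮m (below-antidiagonal (pd⇒above-antidiagonal Q pdQ r c crossQ)))
  ...   | false | false = refl

module SlideRows {n : ℕ} {P : Grid n} {i} (pd : isPipeDream P ≡ true) (S : Slidable P i)
                 (elbow-A : crossAt P (suc i) (Slidable.j S) ≡ false) where

  open Slidable S
  open Slide pd S

  private
    moved : ℕ
    moved = suc (suc (i + j))

    row-i : rowWord P i ≡ rowWord slid i ∷ʳ moved
    row-i = trans (cong (map (λ c → suc (i + c))) removed)
      (trans (map-++ (λ c → suc (i + c)) (filterᵇ (crossAt slid i) (downFrom (n ∸ suc i))) (suc j ∷ []))
             (cong (λ k → rowWord slid i ∷ʳ suc k) (+-suc i j)))
      where
      removed = filterᵇ-downFrom-remove-last (crossAt P i) (crossAt slid i) (suc j) (n ∸ suc i)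
        (below-antidiagonal (pd⇒above-antidiagonal P pd i (suc j) leftmost)) leftmost slid-D
        (λ c c≢j+1 → slid-agree (λ eq → 1+n≢n (sym (,-injectiveˡ eq))) (c≢j+1 ∘′ ,-injectiveʳ))
        (λ c c<j+1 → left-empty c (≤-pred c<j+1))

    row-i+1 : rowWord slid (suc i) ≡ moved ∷ rowWord P (suc i)
    row-i+1 = cong (map (λ c → suc (suc i + c)))
      (filterᵇ-downFrom-add-head (crossAt P (suc i)) (crossAt slid (suc i)) j (n ∸ suc (suc i))
        (below-antidiagonal (pd⇒above-antidiagonal slid slid-pd (suc i) j slid-A)) slid-A elbow-A
        (λ c c≢j → slid-agree (c≢j ∘′ ,-injectiveʳ) (λ eq → 1+n≢n (,-injectiveˡ eq)))
        below-right-empty)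

    row-other : ∀ r → r ≢ i → r ≢ suc i → rowWord slid r ≡ rowWord P r
    row-other r r≢i r≢i+1 = cong (map (λ c → suc (r + c)))
      (filterᵇ-downFrom-cong (crossAt slid r) (crossAt P r) (n ∸ suc r)
        (λ c _ → sym (slid-agree (r≢i+1 ∘′ ,-injectiveˡ) (r≢i ∘′ ,-injectiveˡ))))

  slide-rowWords : concat (rowWords slid) ≡ concat (rowWords P) × weight (rowWords slid) ≡ suc (weight (rowWords P))
  slide-rowWords = move-letter-down n (rowWord P) (rowWord slid) i moved suc-i<n row-i row-i+1 row-other

NoRepeat : List ℕ → Set
NoRepeat S = ∀ U ℓ V → S ≢ U ++ ℓ ∷ ℓ ∷ V

-- Sliding onto a cross would put the same letter at the end of row i and the start of row i + 1.
slide-onto-cross-repeats : ∀ {n} (P : Grid n) → isPipeDream P ≡ true → ∀ {i} (S : Slidable P i) →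
                           crossAt P (suc i) (Slidable.j S) ≡ true → ¬ NoRepeat (concat (rowWords P))
slide-onto-cross-repeats {n} P pd {i} S cross-A noRepeat
  with Rows.rowWord-last P pd i (suc j) leftmost (λ c c<j → left-empty c (≤-pred c<j))
     | Rows.rowWord-head P pd (suc i) j cross-A below-right-empty
  where open Slidable S
... | X , last | Y , head
  with adjacent-rows-repeat n (rowWord P) i X _ Y suc-i<n (trans last (cong (λ k → X ∷ʳ suc k) (+-suc i (Slidable.j S)))) head
  where
  suc-i<n = ≤-trans (s≤s (s≤s (m≤m+n i (Slidable.j S)))) (<⇒≤ (pd⇒above-antidiagonal P pd (suc i) (Slidable.j S) cross-A))
... | U , V , repeat = noRepeat U _ V repeat

slide-fixes⇒stuck : ∀ {n} (P : Grid n) → isPipeDream P ≡ true → ∀ i → gridEq (slide P i) P ≡ true → slideCol P i ≡ nothing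
slide-fixes⇒stuck P pd i fixes with slide-case P i
... | empty-row stuck _ = stuck
... | cross-in-column-0 stuck _ = stuck
... | blocked stuck _ _ _ _ _ _ _ = stuck
... | slidable S = ⊥-elim (false≢true (trans (sym removed) (Slidable.leftmost S)))
  where
  open Slide pd S
  removed : crossAt P i (suc (Slidable.j S)) ≡ false
  removed = trans (cong (λ G → crossAt G i (suc (Slidable.j S))) (trans (sym (gridEq-sound _ _ fixes)) slide≡slid)) slid-D

stuck⇒fixed : ∀ {n} (P : Grid n) i → slideCol P i ≡ nothing → gridEq (slide P i) P ≡ true
stuck⇒fixed P i stuck = trans (cong (λ G → gridEq G P) (slide-stuck P i stuck)) (gridEq-refl P)

slide-moves⇒slidable : ∀ {n} (P : Grid n) i → gridEq (slide P i) P ≡ false → Slidable P i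
slide-moves⇒slidable P i moves with slide-case P i
... | slidable S = S
... | empty-row stuck _ = ⊥-elim (false≢true (trans (sym moves) (stuck⇒fixed P i stuck)))
... | cross-in-column-0 stuck _ = ⊥-elim (false≢true (trans (sym moves) (stuck⇒fixed P i stuck)))
... | blocked stuck _ _ _ _ _ _ _ = ⊥-elim (false≢true (trans (sym moves) (stuck⇒fixed P i stuck)))

-- The descent dst₀

firstMove-nothing : ∀ {n} (P : Grid n) is → firstMove P is ≡ nothing → ∀ {i} → i ∈ is → gridEq (slide P i) P ≡ true
firstMove-nothing P (i ∷ is) none i∈ with gridEq (slide P i) P in fixes
firstMove-nothing P (i ∷ is) none (here refl) | true = fixes
firstMove-nothing P (i ∷ is) none (there i∈) | true = firstMove-nothing P is none i∈

firstMove-just : ∀ {n} (P : Grid n) is {P'} → firstMove P is ≡ just P' → ∃[ i ] gridEq (slide P i) P ≡ false × P' ≡ slide P i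
firstMove-just P (i ∷ is) found with gridEq (slide P i) P in fixes
... | true = firstMove-just P is found
firstMove-just P (i ∷ is) refl | false = i , fixes , refl

dstIter-stop : ∀ {n} f (P : Grid n) → firstMove P (slideIndices n) ≡ nothing → dstIter (suc f) P ≡ P
dstIter-stop f P none rewrite none = refl

dstIter-move : ∀ {n} f (P : Grid n) {P'} → firstMove P (slideIndices n) ≡ just P' → dstIter (suc f) P ≡ dstIter f P'
dstIter-move f P found rewrite found = refl

dstIter-invariant : ∀ {n} (I : Grid n → Set) → (∀ P i → I P → gridEq (slide P i) P ≡ false → I (slide P i)) →
                    ∀ f P → I P → I (dstIter f P)
dstIter-invariant I step zero P holds = holds
dstIter-invariant {n} I step (suc f) P holds with firstMove P (slideIndices n) in found
... | nothing = holds
... | just P' with firstMove-just P (slideIndices n) found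
...   | i , moves , refl = dstIter-invariant I step f (slide P i) (step P i holds moves)

-- Either hypothesis rules out sliding a cross onto a cross (reduced-no-double-cross, slide-onto-cross-repeats).
module Descent {n : ℕ} (w : Permutation′ n) (S : List ℕ) (reduced shaped : Bool) (tame : reduced ≡ true ⊎ NoRepeat S) where

  Invariant : Grid n → Set
  Invariant P = isPipeDream P ≡ true × concat (rowWords P) ≡ S × isReduced P ≡ reduced × hasShape w P ≡ shaped

  slide-step : ∀ P i → Invariant P → gridEq (slide P i) P ≡ false →
               Invariant (slide P i) × weight (rowWords (slide P i)) ≡ suc (weight (rowWords P))
  slide-step P i (pd , word≡ , reduced≡ , shape≡) moves with slide-moves⇒slidable P i moves
  ... | Sl with crossAt P (suc i) (Slidable.j Sl) in cross-A
  ...   | true = ⊥-elim (collision tame)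
    where
    open Slidable Sl
    collision : reduced ≡ true ⊎ NoRepeat S → ⊥
    collision (inj₁ refl) = reduced-no-double-cross P pd reduced≡ i j cross-A leftmost (left-empty j ≤-refl) (below-right-empty (suc j) ≤-refl)
    collision (inj₂ noRepeat) = slide-onto-cross-repeats P pd Sl cross-A (subst NoRepeat (sym word≡) noRepeat)
  ...   | false rewrite Slide.slide≡slid pd Sl =
    ( slid-pd , trans (proj₁ slide-rowWords) word≡
    , trans (sym (reduced-preserved cross-A)) reduced≡ , trans (sym (shape-preserved cross-A w)) shape≡ )
    , proj₂ slide-rowWords
    where
    open Slide pd Sl
    open SlideRows pd Sl cross-A

  descent-invariant : ∀ f P → Invariant P → Invariant (dstIter f P)
  descent-invariant = dstIter-invariant Invariant (λ P i inv moves → proj₁ (slide-step P i inv moves))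

  weight-≤ : ∀ P → Invariant P → weight (rowWords P) ≤ (n ∸ 1) * length S
  weight-≤ P (_ , word≡ , _) = ≤-trans (weight-bound (rowWords P))
    (≤-reflexive (cong₂ (λ k U → (k ∸ 1) * length U) (length-applyUpTo (rowWord P) n) word≡))

  descent-stops : ∀ f P → Invariant P → (n ∸ 1) * length S < weight (rowWords P) + f →
                  firstMove (dstIter f P) (slideIndices n) ≡ nothing
  descent-stops zero P inv enough = ⊥-elim (<⇒≱ enough (≤-trans (≤-reflexive (+-identityʳ _)) (weight-≤ P inv)))
  descent-stops (suc f) P inv enough = continue _ refl
    where
    continue : ∀ m → firstMove P (slideIndices n) ≡ m → firstMove (dstIter (suc f) P) (slideIndices n) ≡ nothing
    continue nothing found = trans (cong (λ G → firstMove G (slideIndices n)) (dstIter-stop f P found)) found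
    continue (just P') found with firstMove-just P (slideIndices n) found
    ... | i , moves , refl with slide-step P i inv moves
    ...   | inv' , heavier = trans (cong (λ G → firstMove G (slideIndices n)) (dstIter-move f P found))
      (descent-stops f (slide P i) inv' (≤-trans enough (≤-reflexive (trans (+-suc _ f) (cong (_+ f) (sym heavier))))))

-- Facets of the slide complex

filterᵇ-accept : ∀ {A : Set} (p : A → Bool) {x} xs → p x ≡ true → filterᵇ p (x ∷ xs) ≡ x ∷ filterᵇ p xs
filterᵇ-accept p xs px = filter-accept (λ x → T? (p x)) (Equivalence.from T-≡ px)

filterᵇ-reject : ∀ {A : Set} (p : A → Bool) {x} xs → p x ≡ false → filterᵇ p (x ∷ xs) ≡ filterᵇ p xs
filterᵇ-reject p xs px = filter-reject (λ x → T? (p x)) (λ t → false≢true (trans (sym px) (Equivalence.to T-≡ t)))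

filterᵇ-cong : ∀ {A : Set} (p q : A → Bool) xs → (∀ x → x ∈ xs → p x ≡ q x) → filterᵇ p xs ≡ filterᵇ q xs
filterᵇ-cong p q [] same = refl
filterᵇ-cong p q (x ∷ xs) same with p x in px
... | true = trans (cong (x ∷_) (filterᵇ-cong p q xs (λ y y∈ → same y (there y∈))))
                   (sym (filterᵇ-accept q xs (trans (sym (same x (here refl))) px)))
... | false = trans (filterᵇ-cong p q xs (λ y y∈ → same y (there y∈)))
                    (sym (filterᵇ-reject q xs (trans (sym (same x (here refl))) px)))

without : (Cell → Bool) → Cell → Cell → Bool
without q x y = q y ∧ not (cellEq y x)

without-≢ : ∀ q {x y} → y ≢ x → without q x y ≡ q y
without-≢ q {x} {y} y≢x = trans (cong (λ b → q y ∧ not b) (cellEq-≢ y x y≢x)) (∧-identityʳ (q y))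

without-self : ∀ q x → without q x x ≡ false
without-self q x = trans (cong (λ b → q x ∧ not b) (cellEq-refl x)) (∧-zeroʳ (q x))

-- A strictly shorter subword skips some cross, which can then be removed.
drop-skipped : ∀ ps → Unique ps → (q : Cell → Bool) → ∀ {S} → S ⊆ map letter (filterᵇ q ps) →
               length S < countᵇ q ps → ∃[ x ] x ∈ ps × q x ≡ true × S ⊆ map letter (filterᵇ (without q x) ps)
drop-skipped (y ∷ ps) (y≢ps ∷ unique) q {S} sub shorter = by-cases (q y) refl
  where
  y≢ : ∀ {x} → x ∈ ps → y ≢ x
  y≢ x∈ = All.lookup y≢ps x∈

  skip-y : filterᵇ (without q y) (y ∷ ps) ≡ filterᵇ q ps
  skip-y = trans (filterᵇ-reject (without q y) ps (without-self q y))
                 (filterᵇ-cong _ q ps (λ x x∈ → without-≢ q (≢-sym (y≢ x∈))))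

  kept : ∀ S' → S' ⊆ letter y ∷ map letter (filterᵇ q ps) → length S' < suc (countᵇ q ps) → q y ≡ true →
         ∃[ x ] x ∈ y ∷ ps × q x ≡ true × S' ⊆ map letter (filterᵇ (without q x) (y ∷ ps))
  kept S' (skip _ sub') _ qy = y , here refl , qy , subst (λ xs → S' ⊆ map letter xs) (sym skip-y) sub'
  kept (_ ∷ S') (refl ∷ sub') (s≤s shorter') qy with drop-skipped ps unique q sub' shorter'
  ... | x , x∈ , qx , sub'' = x , there x∈ , qx ,
    subst (λ xs → _ ⊆ map letter xs) (sym (filterᵇ-accept (without q x) ps (trans (without-≢ q (y≢ x∈)) qy))) (refl ∷ sub'')

  by-cases : ∀ b → q y ≡ b → ∃[ x ] x ∈ y ∷ ps × q x ≡ true × S ⊆ map letter (filterᵇ (without q x) (y ∷ ps))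
  by-cases true qy = kept S (subst (λ xs → S ⊆ map letter xs) (filterᵇ-accept q ps qy) sub)
                            (subst (λ xs → length S < length xs) (filterᵇ-accept q ps qy) shorter) qy
  by-cases false qy with drop-skipped ps unique q (subst (λ xs → S ⊆ map letter xs) (filterᵇ-reject q ps qy) sub)
                                                  (subst (λ xs → length S < length xs) (filterᵇ-reject q ps qy) shorter)
  ... | x , x∈ , qx , sub' = x , there x∈ , qx ,
    subst (λ xs → S ⊆ map letter xs) (sym (filterᵇ-reject (without q x) ps (cong (_∧ not (cellEq y x)) qy))) sub'

bit-mono : ∀ {a b} → (a ≡ true → b ≡ true) → bit a ≤ bit b
bit-mono {false} _ = z≤n
bit-mono {true} a⇒b rewrite a⇒b refl = ≤-refl

bit-≤⇒ : ∀ {a b} → bit a ≤ bit b → a ≡ true → b ≡ true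
bit-≤⇒ {b = true} _ _ = refl
bit-≤⇒ {b = false} () refl

countᵇ-mono : ∀ {A : Set} (p q : A → Bool) xs → (∀ x → x ∈ xs → p x ≡ true → q x ≡ true) → countᵇ p xs ≤ countᵇ q xs
countᵇ-mono p q [] _ = z≤n
countᵇ-mono p q (x ∷ xs) p⇒q = subst₂ _≤_ (sym (countᵇ-∷ p x xs)) (sym (countᵇ-∷ q x xs))
  (+-mono-≤ (bit-mono (p⇒q x (here refl))) (countᵇ-mono p q xs (λ y y∈ → p⇒q y (there y∈))))

sum-squeeze : ∀ {a a' c c'} → a' ≤ a → c' ≤ c → a + c ≤ a' + c' → a ≤ a' × c ≤ c'
sum-squeeze {a} {a'} {c} {c'} a'≤a c'≤c le =
  +-cancelʳ-≤ c a a' (≤-trans le (+-monoʳ-≤ a' c'≤c)) , +-cancelˡ-≤ a c c' (≤-trans le (+-monoˡ-≤ c' a'≤a))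

countᵇ-rigid : ∀ {A : Set} (p q : A → Bool) xs → (∀ x → x ∈ xs → p x ≡ true → q x ≡ true) →
               countᵇ q xs ≤ countᵇ p xs → ∀ x → x ∈ xs → q x ≡ true → p x ≡ true
countᵇ-rigid p q (y ∷ xs) p⇒q fewer x x∈ qx
  with sum-squeeze (bit-mono (p⇒q y (here refl))) (countᵇ-mono p q xs (λ z z∈ → p⇒q z (there z∈)))
                   (subst₂ _≤_ (countᵇ-∷ q y xs) (countᵇ-∷ p y xs) fewer)
countᵇ-rigid p q (y ∷ xs) p⇒q fewer x (here refl) qx | head , _ = bit-≤⇒ head qx
countᵇ-rigid p q (y ∷ xs) p⇒q fewer x (there x∈) qx | _ , rest = countᵇ-rigid p q xs (λ z z∈ → p⇒q z (there z∈)) rest x x∈ qx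

positions-unique : ∀ n → Unique (positions n)
positions-unique n = Unique.concat⁺ (All.map⁺ (All.universal row-unique (upTo n)))
                                    (AllPairs.map⁺ (AllPairs.map rows-disjoint (Unique.upTo⁺ n)))
  where
  cells : ℕ → List Cell
  cells r = map (r ,_) (downFrom (n ∸ suc r))
  row-unique : ∀ r → Unique (cells r)
  row-unique r = Unique.map⁺ ,-injectiveʳ (Unique.downFrom⁺ (n ∸ suc r))
  rows-disjoint : ∀ {r r'} → r ≢ r' → Disjoint (cells r) (cells r')
  rows-disjoint r≢r' (x∈ , x∈') with ∈-map⁻ _ x∈ | ∈-map⁻ _ x∈'
  ... | _ , _ , refl | _ , _ , same = r≢r' (,-injectiveˡ same)

cross∈positions : ∀ {n} (P : Grid n) → isPipeDream P ≡ true → ∀ {r c} → crossAt P r c ≡ true → (r , c) ∈ positions n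
cross∈positions {n} P pd {r} {c} cross =
  ∈-concat⁺′ (∈-map⁺ (r ,_) (∈-downFrom⁺ (below-antidiagonal (pd⇒above-antidiagonal P pd r c cross))))
             (∈-map⁺ (λ r → map (r ,_) (downFrom (n ∸ suc r))) (∈-upTo⁺ (proj₁ (crossAt-bounded P cross))))

allVecs-complete : ∀ {A : Set} (xs : List A) → (∀ a → a ∈ xs) → ∀ k (v : Vec A k) → v ∈ allVecs xs k
allVecs-complete xs every zero V.[] = here refl
allVecs-complete xs every (suc k) (a V.∷ v) =
  ∈-concat⁺′ (∈-map⁺ (a V.∷_) (allVecs-complete xs every k v)) (∈-map⁺ (λ x → map (x V.∷_) (allVecs xs k)) (every a))

∈-pipeDreams : ∀ {n} (P : Grid n) → isPipeDream P ≡ true → P ∈ pipeDreams n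
∈-pipeDreams {n} P pd = ∈-filter⁺ (λ G → T? (isPipeDream G))
  (allVecs-complete _ (allVecs-complete _ every-bool n) n P) (Equivalence.from T-≡ pd)
  where
  every-bool : ∀ b → b ∈ true ∷ false ∷ []
  every-bool true = here refl
  every-bool false = there (here refl)

∈-pipeDreams⁻ : ∀ {n} {P : Grid n} → P ∈ pipeDreams n → isPipeDream P ≡ true
∈-pipeDreams⁻ {n} P∈ = Equivalence.to T-≡ (proj₂ (∈-filter⁻ (λ G → T? (isPipeDream G)) {xs = allGrids n} P∈))

does⇒ : ∀ {X : Set} (d : Dec X) → does d ≡ true → X
does⇒ (yes x) _ = x

bool-ext : ∀ {a b} → (a ≡ true → b ≡ true) → (b ≡ true → a ≡ true) → a ≡ b
bool-ext {true} a⇒b _ = sym (a⇒b refl)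
bool-ext {false} {true} _ b⇒a = b⇒a refl
bool-ext {false} {false} _ _ = refl

crossed : ∀ {n} → Grid n → Cell → Bool
crossed P x = crossAt P (proj₁ x) (proj₂ x)

crossed-erase : ∀ {n} (P : Grid n) {r c} → crossAt P r c ≡ true → ∀ y →
                crossed (setCell P r c false) y ≡ without (crossed P) (r , c) y
crossed-erase P {r} {c} cross (r' , c') with (r' , c') ≟ᶜ (r , c)
... | yes refl = trans (crossAt-setCell-≡ P false (proj₁ (crossAt-bounded P cross)) (proj₂ (crossAt-bounded P cross)))
                       (sym (without-self (crossed P) (r , c)))
... | no ≢x = trans (crossAt-setCell-≢ P false (≢-sym ≢x)) (sym (without-≢ (crossed P) ≢x))

module Facets {n : ℕ} (S : List ℕ) where

  crossSubset⇒ : ∀ {P' P : Grid n} → crossSubset P' P ≡ true → ∀ {r c} → crossAt P' r c ≡ true → crossAt P r c ≡ true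
  crossSubset⇒ {P'} sub cross' with crossAt-bounded P' cross'
  ... | r<n , c<n = not-∨-elim (all-∈ _ sub (∈-allCells r<n c<n)) cross'

  crossSubset-intro : ∀ (P' P : Grid n) → (∀ {r c} → crossAt P' r c ≡ true → crossAt P r c ≡ true) → crossSubset P' P ≡ true
  crossSubset-intro P' P sub = all-intro _ (allCells n) (λ _ _ → not-∨-intro sub)

  length-word : ∀ (P : Grid n) → length (word P) ≡ countᵇ (crossed P) (positions n)
  length-word P = length-map letter (filterᵇ (crossed P) (positions n))

  subgrid-no-shorter : ∀ (P' P : Grid n) → isPipeDream P ≡ true → crossSubset P' P ≡ true →
                       length (word P) ≤ length (word P') → P' ≡ P
  subgrid-no-shorter P' P pd sub no-shorter = grid-ext P' P λ r c _ _ →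
    bool-ext (crossSubset⇒ {P'} {P} sub) (λ cross → countᵇ-rigid (crossed P') (crossed P) (positions n) (λ _ _ → crossSubset⇒ {P'} {P} sub)
      (subst₂ _≤_ (length-word P) (length-word P') no-shorter) (r , c) (cross∈positions P pd cross) cross)

  in-complex : ∀ (P : Grid n) → isPipeDream P ≡ true → S ⊆ word P → inSlideComplex S P ≡ true
  in-complex P pd sub = cong₂ _∧_ pd (dec-true (S ⊆? word P) sub)

  in-complex⁻ : ∀ (P : Grid n) → inSlideComplex S P ≡ true → S ⊆ word P
  in-complex⁻ P inside = does⇒ (S ⊆? word P) (proj₂ (∧≡true⁻ {isPipeDream P} inside))

  word≡⇒facet : ∀ P → isPipeDream P ≡ true → word P ≡ S → isFacet S P ≡ true
  word≡⇒facet P pd word≡ = cong₂ _∧_ (in-complex P pd (subst (S ⊆_) (sym word≡) ⊆-refl)) (all-intro _ (pipeDreams n) maximal)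
    where
    maximal : ∀ P' → P' ∈ pipeDreams n → not (inSlideComplex S P' ∧ crossSubset P' P ∧ not (gridEq P' P)) ≡ true
    maximal P' _ with inSlideComplex S P' in inside | crossSubset P' P in sub
    ... | false | _ = refl
    ... | true | false = refl
    ... | true | true = cong (λ b → not (not b)) (trans (cong (λ G → gridEq G P) P'≡P) (gridEq-refl P))
      where
      P'≡P = subgrid-no-shorter P' P pd sub (subst (_≤ length (word P')) (cong length (sym word≡))
                                              (length-mono-≤ (in-complex⁻ P' inside)))

  facet⇒word≡ : ∀ P → isPipeDream P ≡ true → isFacet S P ≡ true → word P ≡ S
  facet⇒word≡ P pd facet with ∧≡true⁻ {inSlideComplex S P} facet
  ... | inside , maximal with length (word P) ≤? length S
  ...   | yes short = sym (≋⇒≡ (to-≋ (≤-antisym (length-mono-≤ (in-complex⁻ P inside)) short) (in-complex⁻ P inside)))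
  ...   | no long with drop-skipped (positions n) (positions-unique n) (crossed P) (in-complex⁻ P inside)
                                    (subst (length S <_) (length-word P) (≰⇒> long))
  ...     | (r , c) , _ , cross , sub' = ⊥-elim (false≢true (trans (sym smaller-facet) (all-∈ _ maximal (∈-pipeDreams P' pd'))))
    where
    P' = setCell P r c false
    crossed-P' : ∀ y → crossed P' y ≡ without (crossed P) (r , c) y
    crossed-P' = crossed-erase P cross
    in-P : ∀ {r' c'} → crossAt P' r' c' ≡ true → crossAt P r' c' ≡ true
    in-P {r'} {c'} cross' = proj₁ (∧≡true⁻ (trans (sym (crossed-P' (r' , c'))) cross'))
    pd' : isPipeDream P' ≡ true
    pd' = above-antidiagonal⇒pd P' (λ {r'} {c'} cross' → pd⇒above-antidiagonal P pd r' c' (in-P cross'))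
    erased : gridEq P' P ≡ false
    erased with gridEq P' P in same
    ... | false = refl
    ... | true = ⊥-elim (false≢true (trans (sym (trans (crossed-P' (r , c)) (without-self (crossed P) (r , c))))
                                           (trans (cong (λ G → crossAt G r c) (gridEq-sound P' P same)) cross)))
    smaller-facet : not (inSlideComplex S P' ∧ crossSubset P' P ∧ not (gridEq P' P)) ≡ false
    smaller-facet = cong not (cong₂ _∧_ (in-complex P' pd' sub-P') (cong₂ _∧_ (crossSubset-intro P' P in-P) (cong not erased)))
      where
      sub-P' = subst (λ xs → S ⊆ map letter xs) (sym (filterᵇ-cong _ _ (positions n) (λ y _ → crossed-P' y))) sub'

length-rowWord : ∀ {n} (P : Grid n) r → length (rowWord P r) ≤ n
length-rowWord {n} P r = begin
  length (rowWord P r)                                     ≡⟨ length-map _ (filterᵇ (crossAt P r) (downFrom (n ∸ suc r))) ⟩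
  length (filterᵇ (crossAt P r) (downFrom (n ∸ suc r)))    ≤⟨ length-filter (λ c → T? (crossAt P r c)) (downFrom (n ∸ suc r)) ⟩
  length (downFrom (n ∸ suc r))                            ≡⟨ length-downFrom (n ∸ suc r) ⟩
  n ∸ suc r                                                ≤⟨ m∸n≤m n (suc r) ⟩
  n                                                        ∎
  where open ≤-Reasoning

weight-room : ∀ m L → L ≤ suc m * suc m → (suc m ∸ 1) * L < suc m * suc m * suc m
weight-room m L L≤ = begin-strict
  m * L                        ≤⟨ *-monoʳ-≤ m L≤ ⟩
  m * (n * n)                  <⟨ m<n+m (m * (n * n)) (s≤s z≤n) ⟩
  n * n + m * (n * n)          ≡⟨ *-comm n (n * n) ⟩
  n * n * n                    ∎
  where
  open ≤-Reasoning
  n = suc m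

module _ {n : ℕ} (w : Permutation′ n) (Q : Grid n) (Q∈ : inQPD0 w Q ≡ true) where

  private
    pdQ : isPipeDream Q ≡ true
    pdQ = proj₁ (∧≡true⁻ Q∈)

    reducedQ : isReduced Q ≡ true
    reducedQ = proj₁ (∧≡true⁻ (proj₂ (∧≡true⁻ {isPipeDream Q} Q∈)))

    shapeQ : hasShape w Q ≡ true
    shapeQ = proj₁ (∧≡true⁻ (proj₂ (∧≡true⁻ {isReduced Q} (proj₂ (∧≡true⁻ {isPipeDream Q} Q∈)))))

    yamanouchiQ : isQuasiYam Q ≡ true
    yamanouchiQ = proj₂ (∧≡true⁻ {hasShape w Q} (proj₂ (∧≡true⁻ {isReduced Q} (proj₂ (∧≡true⁻ {isPipeDream Q} Q∈)))))

    S : List ℕ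
    S = concat (rowWords Q)

    i∈slideIndices : ∀ {i} → suc i < n → i ∈ slideIndices n
    i∈slideIndices {i} i+1<n = ∈-upTo⁺ (m+n≤o⇒m≤o∸n (suc i) (≤-trans (≤-reflexive (+-comm (suc i) 1)) i+1<n))

    qy-rows : ∀ (D : Grid n) → isPipeDream D ≡ true → (∀ i → suc i < n → gridEq (slide D i) D ≡ true) →
              QuasiYamanouchi 0 (rowWords D)
    qy-rows D pd fixed = Rows.qy-rowWords D pd (λ i i+1<n → slide-fixes⇒stuck D pd i (fixed i i+1<n))

    qyQ : QuasiYamanouchi 0 (rowWords Q)
    qyQ = qy-rows Q pdQ (λ i i+1<n → all-∈ _ yamanouchiQ (i∈slideIndices i+1<n))

  dst0-preimage⇒same-word : ∀ P → isPipeDream P ≡ true → (isReduced P ∧ hasShape w P ∧ gridEq (dst0 P) Q) ≡ true →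
                            word P ≡ word Q
  dst0-preimage⇒same-word P pd in-preimage with ∧≡true⁻ in-preimage
  ... | reduced , rest = begin
    word P                       ≡⟨ word≡concat-rowWords P ⟩
    concat (rowWords P)          ≡⟨ sym (proj₁ (proj₂ (descent-invariant (n * n * n) P (pd , refl , reduced , refl)))) ⟩
    concat (rowWords (dst0 P))   ≡⟨ cong (concat ∘′ rowWords) (gridEq-sound (dst0 P) Q (proj₂ (∧≡true⁻ {hasShape w P} rest))) ⟩
    concat (rowWords Q)          ≡⟨ sym (word≡concat-rowWords Q) ⟩
    word Q                       ∎
    where
    open ≡-Reasoning
    open Descent w (concat (rowWords P)) true (hasShape w P) (inj₁ refl)

  same-word⇒dst0-preimage : ∀ P → isPipeDream P ≡ true → word P ≡ word Q →
                            (isReduced P ∧ hasShape w P ∧ gridEq (dst0 P) Q) ≡ true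
  same-word⇒dst0-preimage P pd same = begin
    isReduced P ∧ hasShape w P ∧ gridEq (dst0 P) Q     ≡⟨ cong₂ (λ a b → a ∧ b ∧ gridEq (dst0 P) Q) (sym reduced≡) (sym shape≡) ⟩
    isReduced D ∧ hasShape w D ∧ gridEq D Q            ≡⟨ cong (λ G → isReduced G ∧ hasShape w G ∧ gridEq G Q) D≡Q ⟩
    isReduced Q ∧ hasShape w Q ∧ gridEq Q Q            ≡⟨ cong₂ (λ a b → a ∧ b ∧ gridEq Q Q) reducedQ shapeQ ⟩
    gridEq Q Q                                         ≡⟨ gridEq-refl Q ⟩
    true                                               ∎
    where
    open ≡-Reasoning
    open Descent w S (isReduced P) (hasShape w P) (inj₂ (qy-no-repeat qyQ))

    invP : Invariant P
    invP = pd , trans (sym (word≡concat-rowWords P)) (trans same (word≡concat-rowWords Q)) , refl , refl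

    D = dst0 P
    invD = descent-invariant (n * n * n) P invP
    reduced≡ = proj₁ (proj₂ (proj₂ invD))
    shape≡ = proj₂ (proj₂ (proj₂ invD))

    stopped : firstMove D (slideIndices n) ≡ nothing
    stopped = by-size n refl
      where
      by-size : ∀ k → n ≡ k → firstMove D (slideIndices n) ≡ nothing
      by-size zero refl = refl
      by-size (suc m) refl = descent-stops (n * n * n) P invP (≤-trans (weight-room m (length S) short) (m≤n+m _ _))
        where short = length-concat-applyUpTo n (rowWord Q) n (length-rowWord Q)

    D≡Q : D ≡ Q
    D≡Q = rowWords-injective D Q (proj₁ invD) pdQ (qy-unique (rowWords D) (rowWords Q)
      (qy-rows D (proj₁ invD) (λ i i+1<n → firstMove-nothing D (slideIndices n) stopped (i∈slideIndices i+1<n))) qyQ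
      (trans (length-applyUpTo (rowWord D) n) (sym (length-applyUpTo (rowWord Q) n))) (proj₁ (proj₂ invD)))

  dst0-preimage≡facet : ∀ P → P ∈ pipeDreams n → (isReduced P ∧ hasShape w P ∧ gridEq (dst0 P) Q) ≡ isFacet (word Q) P
  dst0-preimage≡facet P P∈ = bool-ext
    (λ preimage → word≡⇒facet P pd (dst0-preimage⇒same-word P pd preimage))
    (λ facet → same-word⇒dst0-preimage P pd (facet⇒word≡ P pd facet))
    where
    pd = ∈-pipeDreams⁻ P∈
    open Facets (word Q)

corollary4p11 : (n : ℕ) (w : Permutation′ n) (Q : Grid n) → T (inQPD0 w Q) →
                slidePoly w Q ≈ₚ facetPoly (word Q)
corollary4p11 n w Q Q∈ = ↭-reflexive (cong (map xMon)
  (filterᵇ-cong _ _ (pipeDreams n) (dst0-preimage≡facet w Q (Equivalence.to T-≡ Q∈))))
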